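{- Let $G$ be a connected graph with $\dim(G)=n(G)-2\geq 2$, and let $\ell\geq 1$ be an integer. Then $D(G)=n(G)-\ell$ if and only if $G$ is isomorphic to one of the following graphs: (a) $K_{\ell+1,\ell+1}$; (b) $K_{t,\ell}$ with $t\geq \ell+1$; (c) $K_\ell+\overline{K_t}$ with $t\geq \ell$; (d) $K_t+\overline{K_\ell}$ with $t\geq \ell\geq 2$; (e) $K_{\ell-1}+(K_t\cup K_1)$ with $t\geq\max\{2,\ell-1\}$; (f) $K_t+(K_{\ell-1}\cup K_1)$ with $t\geq \max\{2,\ell-1\}$.
   Context: All graphs are finite and simple; $n(G)$ is the number of vertices. For a connected graph $G$ with shortest-path distance $d_G$, a set $S\subseteq V(G)$ is a resolving set if for any two distinct vertices $g_1,g_2$ there is $s\in S$ with $d_G(g_1,s)\neq d_G(g_2,s)$; $\dim(G)$ is the minimum size of a resolving set. The distinguishing number $D(G)$ is the minimum number of colors in a vertex coloring preserved by no non-trivial automorphism of $G$. Notation: $K_n$ complete graph, $\overline{K_n}$ edgeless graph on $n$ vertices, $K_{s,t}$ complete bipartite graph, $\cup$ disjoint union, $G+H$ the join of $G$ and $H$. -}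

module Defs where

open import Data.Nat using (ℕ; zero; suc; _+_; _≤_)
open import Data.Bool using (Bool; true; false; _∧_; not)
open import Data.Fin using (Fin; splitAt; _≟_)
open import Data.Fin.Subset using (Subset; _∈_; ∣_∣)
open import Data.Sum using (_⊎_; inj₁; inj₂)
open import Data.Product using (Σ; ∃; _×_; _,_)
open import Relation.Binary.PropositionalEquality using (_≡_; _≢_; refl)
open import Relation.Nullary using (does)
open import Function.Bundles using (_↔_; Inverse)

record Graph (n : ℕ) : Set where
  field
    adj    : Fin n → Fin n → Bool
    sym    : ∀ u v → adj u v ≡ adj v u
    irrefl : ∀ v → adj v v ≡ false
open Graph public

record _≅_ {n m : ℕ} (G : Graph n) (H : Graph m) : Set where
  field
    bij  : Fin n ↔ Fin m
    pres : ∀ u v → adj H (Inverse.to bij u) (Inverse.to bij v) ≡ adj G u v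
open _≅_ public

Aut : ∀ {n} → Graph n → Set
Aut G = G ≅ G

data Walk {n} (G : Graph n) : Fin n → Fin n → ℕ → Set where
  here : ∀ {v} → Walk G v v 0
  step : ∀ {u w v k} → adj G u w ≡ true → Walk G w v k → Walk G u v (suc k)

Connected : ∀ {n} → Graph n → Set
Connected G = ∀ u v → ∃ λ k → Walk G u v k

Dist : ∀ {n} → Graph n → Fin n → Fin n → ℕ → Set
Dist G u v d = Walk G u v d × (∀ k → Walk G u v k → d ≤ k)

Resolving : ∀ {n} → Graph n → Subset n → Set
Resolving G S = ∀ g₁ g₂ → g₁ ≢ g₂ →
  Σ _ λ s → s ∈ S × Σ ℕ λ d₁ → Σ ℕ λ d₂ →
    Dist G g₁ s d₁ × Dist G g₂ s d₂ × d₁ ≢ d₂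

IsMetricDim : ∀ {n} → Graph n → ℕ → Set
IsMetricDim G m =
  (Σ _ λ S → Resolving G S × ∣ S ∣ ≡ m) ×
  (∀ S → Resolving G S → m ≤ ∣ S ∣)

Distinguishing : ∀ {n k} → Graph n → (Fin n → Fin k) → Set
Distinguishing G c = ∀ (σ : Aut G) →
  (∀ v → c (Inverse.to (bij σ) v) ≡ c v) → ∀ v → Inverse.to (bij σ) v ≡ v

IsDistNum : ∀ {n} → Graph n → ℕ → Set
IsDistNum {n} G k =
  (Σ (Fin n → Fin k) λ c → Distinguishing G c) ×
  (∀ k' (c : Fin n → Fin k') → Distinguishing G c → k ≤ k')

K : ∀ n → Graph n
K n = record { adj = λ u v → not (does (u ≟ v)) ; sym = s ; irrefl = ir }
  where
  s : ∀ u v → not (does (u ≟ v)) ≡ not (does (v ≟ u))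
  s u v with u ≟ v | v ≟ u
  ... | Relation.Nullary.yes _ | Relation.Nullary.yes _ = refl
  ... | Relation.Nullary.no _  | Relation.Nullary.no _  = refl
  ... | Relation.Nullary.yes refl | Relation.Nullary.no ¬p with () ← ¬p refl
  ... | Relation.Nullary.no ¬p | Relation.Nullary.yes refl with () ← ¬p refl
  ir : ∀ v → not (does (v ≟ v)) ≡ false
  ir v with v ≟ v
  ... | Relation.Nullary.yes _ = refl
  ... | Relation.Nullary.no ¬p with () ← ¬p refl

E : ∀ n → Graph n
E n = record { adj = λ _ _ → false ; sym = λ _ _ → refl ; irrefl = λ _ → refl }

sumAdj : ∀ {a b} → Bool → Graph a → Graph b → Fin a ⊎ Fin b → Fin a ⊎ Fin b → Bool
sumAdj c G H (inj₁ i) (inj₁ j) = adj G i j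
sumAdj c G H (inj₂ i) (inj₂ j) = adj H i j
sumAdj c G H (inj₁ _) (inj₂ _) = c
sumAdj c G H (inj₂ _) (inj₁ _) = c

sumAdj-sym : ∀ {a b} c (G : Graph a) (H : Graph b) x y → sumAdj c G H x y ≡ sumAdj c G H y x
sumAdj-sym c G H (inj₁ i) (inj₁ j) = sym G i j
sumAdj-sym c G H (inj₂ i) (inj₂ j) = sym H i j
sumAdj-sym c G H (inj₁ _) (inj₂ _) = refl
sumAdj-sym c G H (inj₂ _) (inj₁ _) = refl

sumAdj-irr : ∀ {a b} c (G : Graph a) (H : Graph b) x → sumAdj c G H x x ≡ false
sumAdj-irr c G H (inj₁ i) = irrefl G i
sumAdj-irr c G H (inj₂ i) = irrefl H i

sumGraph : ∀ {a b} → Bool → Graph a → Graph b → Graph (a + b)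
sumGraph {a} c G H = record
  { adj    = λ u v → sumAdj c G H (splitAt a u) (splitAt a v)
  ; sym    = λ u v → sumAdj-sym c G H (splitAt a u) (splitAt a v)
  ; irrefl = λ v → sumAdj-irr c G H (splitAt a v) }

_∪ᴳ_ : ∀ {a b} → Graph a → Graph b → Graph (a + b)
G ∪ᴳ H = sumGraph false G H

_+ᴳ_ : ∀ {a b} → Graph a → Graph b → Graph (a + b)
G +ᴳ H = sumGraph true G H

Kbip : ∀ s t → Graph (s + t)
Kbip s t = E s +ᴳ E t

{-# OPTIONS --safe #-}

-- In a connected graph G with dim G = n − 2 no three vertices can have all three pairs resolved
-- by vertices outside them, for the other n − 3 vertices would form a resolving set. Hence G has
-- diameter at most 2, a vertex z resolves x and y exactly when it is adjacent to just one of
-- them, and G consists of at most three twin classes, each a clique or an independent set;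
-- working out the adjacencies between the classes leaves K_{a,b}, K_a + \overline{K_b} and
-- K_s + (K_t ∪ K_1). A distinguishing colouring must give twins different colours, and a colouring
-- that is injective on every class is distinguishing unless it allows the sides of K_{a,a} to be
-- swapped. So D(G) is the size of a largest class, plus one for K_{a,a}, and comparing D(G) + ℓ
-- with n singles out the graphs (a)–(f).

module Submission where

open import Defs
open import Data.Bool using (Bool; true; false; not; if_then_else_)
import Data.Bool as Bool
open import Data.Bool.Properties using (¬-not; not-involutive)
open import Data.Empty using (⊥; ⊥-elim)
open import Data.Fin using (Fin; zero; suc; _≟_; splitAt; _↑ˡ_; _↑ʳ_; punchIn; punchOut; inject≤; inject₁; fromℕ; toℕ)
open import Data.Fin.Permutation using (refute; transpose)
import Data.Fin.Permutation.Components as PC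
open import Data.Fin.Properties
  using ( any?; all?; ¬∀⟶∃¬; +↔⊎; injective⇒≤; suc-injective; inject₁-injective; inject≤-injective
        ; toℕ-inject≤; toℕ<n; toℕ-fromℕ; splitAt-join; splitAt-↑ˡ; splitAt-↑ʳ; splitAt⁻¹-↑ˡ; splitAt⁻¹-↑ʳ
        ; ↑ˡ-injective; ↑ʳ-injective; punchInᵢ≢i; punchIn-punchOut; punchOut-punchIn; punchOut-injective
        ; punchOut-cong )
open import Data.Fin.Subset using (_∈_; _∉_; ∣_∣)
open import Data.Nat using (ℕ; zero; suc; _+_; _∸_; _⊔_; _≤_; _<_; z≤n; s≤s)
import Data.Nat.Properties as ℕ
open import Data.Nat.Tactic.RingSolver using (solve-∀)
open import Data.Product using (Σ; ∃; _×_; _,_; proj₁; proj₂)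
open import Data.Sum using (_⊎_; inj₁; inj₂; [_,_]′)
import Data.Sum as Sum
open import Data.Sum.Function.Propositional using (_⊎-↔_)
open import Data.Sum.Properties using (inj₁-injective; inj₂-injective)
open import Data.Vec using (tabulate; lookup)
open import Data.Vec.Properties using (lookup∘tabulate; tabulate∘lookup; lookup⇒[]=; []=⇒lookup)
open import Function using (_∘_; id)
open import Function.Bundles using (_↔_; _⇔_; Inverse; mk↔ₛ′; mk⇔)
open import Function.Properties.Inverse using (↔-refl; ↔-sym; ↔-trans)
open import Function.Related.TypeIsomorphisms using (⊎-comm)
open import Relation.Binary.PropositionalEquality using (_≡_; _≢_; ≢-sym; refl; trans; cong; cong₂)
import Relation.Binary.PropositionalEquality as ≡
open import Relation.Nullary using (¬_; Dec; yes; no; does; contradiction)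
open import Relation.Nullary.Decidable using (decidable-stable; dec-true; dec-false; _×-dec_; _⊎-dec_; _→-dec_; ¬?)

to-injective : ∀ {A B : Set} (e : A ↔ B) {x y} → Inverse.to e x ≡ Inverse.to e y → x ≡ y
to-injective e {x} {y} eq = begin
  x            ≡⟨ strictlyInverseʳ x ⟨
  from (to x)  ≡⟨ cong from eq ⟩
  from (to y)  ≡⟨ strictlyInverseʳ y ⟩
  y            ∎
  where open Inverse e
        open ≡.≡-Reasoning

from-injective : ∀ {A B : Set} (e : A ↔ B) {x y} → Inverse.from e x ≡ Inverse.from e y → x ≡ y
from-injective e = to-injective (↔-sym e)

2≤-of-≢ : ∀ {k} {x y : Fin k} → x ≢ y → 2 ≤ k
2≤-of-≢ {suc zero}    {zero} {zero} x≢y = contradiction refl x≢y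
2≤-of-≢ {suc (suc _)} _                 = s≤s (s≤s z≤n)

T≢F : ∀ {α β} → α ≡ true → β ≡ false → α ≢ β
T≢F refl refl ()

does-true : ∀ {A : Set} (a? : Dec A) → does a? ≡ true → A
does-true (yes a) _ = a

does-false : ∀ {A : Set} (a? : Dec A) → does a? ≡ false → ¬ A
does-false (no ¬a) _ = ¬a

distinct-pair : ∀ {k} → 2 ≤ k → Σ (Fin k) λ i → Σ (Fin k) λ j → i ≢ j
distinct-pair (s≤s (s≤s _)) = zero , suc zero , λ ()

another : ∀ {k} → 2 ≤ k → (i : Fin k) → Σ (Fin k) (_≢ i)
another (s≤s (s≤s _)) zero    = suc zero , λ ()
another (s≤s (s≤s _)) (suc _) = zero , λ ()

3≤-of-≢ : ∀ {k} {x y z : Fin k} → x ≢ y → x ≢ z → y ≢ z → 3 ≤ k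
3≤-of-≢ {suc k} x≢y x≢z y≢z = s≤s (2≤-of-≢ (y≢z ∘ punchOut-injective x≢y x≢z))

injective⇒surjective : ∀ {p q} {h : Fin p → Fin q} → (∀ {x y} → h x ≡ h y → x ≡ y) → q ≤ p → ∀ y → ∃ λ x → h x ≡ y
injective⇒surjective {q = suc q} {h} h-injective q≤p y with any? (λ x → h x ≟ y)
... | yes hit = hit
... | no miss = contradiction (ℕ.≤-trans q≤p (injective⇒≤ h′-injective)) ℕ.1+n≰n
  where
  h′ : Fin _ → Fin q
  h′ x = punchOut λ y≡hx → miss (x , ≡.sym y≡hx)
  h′-injective : ∀ {x x′} → h′ x ≡ h′ x′ → x ≡ x′
  h′-injective {x} {x′} =
    h-injective ∘ punchOut-injective {i = y} (λ y≡hx → miss (x , ≡.sym y≡hx)) (λ y≡hx′ → miss (x′ , ≡.sym y≡hx′))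

count : ∀ {n} → (Fin n → Bool) → ℕ
count {zero}  P = 0
count {suc n} P = if P zero then suc (count (P ∘ suc)) else count (P ∘ suc)

count-complement : ∀ {n} (P : Fin n → Bool) → count P + count (not ∘ P) ≡ n
count-complement {zero}  P = refl
count-complement {suc n} P with P zero
... | true  = cong suc (count-complement (P ∘ suc))
... | false = trans (ℕ.+-suc _ _) (cong suc (count-complement (P ∘ suc)))

record Partition {n} (P : Fin n → Bool) (a b : ℕ) : Set where
  field
    split   : Fin n ↔ (Fin a ⊎ Fin b)
    inside  : ∀ i → P (Inverse.from split (inj₁ i)) ≡ true
    outside : ∀ j → P (Inverse.from split (inj₂ j)) ≡ false

  open Inverse split public

  private
    from-to : ∀ {u x} → to u ≡ x → from x ≡ u
    from-to {u} eq = trans (cong from (≡.sym eq)) (strictlyInverseʳ u)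

  index₂ : ∀ {u} → P u ≡ false → Σ (Fin b) λ j → from (inj₂ j) ≡ u
  index₂ {u} Pu with to u in eq
  ... | inj₂ j = j , from-to eq
  ... | inj₁ i = contradiction (trans (≡.sym (inside i)) (trans (cong P (from-to eq)) Pu)) λ ()

  index₂-≢ : ∀ {u v} (Pu : P u ≡ false) (Pv : P v ≡ false) → u ≢ v → proj₁ (index₂ Pu) ≢ proj₁ (index₂ Pv)
  index₂-≢ Pu Pv u≢v i≡j =
    u≢v (trans (≡.sym (proj₂ (index₂ Pu))) (trans (cong (from ∘ inj₂) i≡j) (proj₂ (index₂ Pv))))

  outside-pair : 2 ≤ b → Σ (Fin n) λ u → Σ (Fin n) λ v → u ≢ v × P u ≡ false × P v ≡ false
  outside-pair 2≤b with distinct-pair 2≤b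
  ... | i , j , i≢j =
    from (inj₂ i) , from (inj₂ j) , i≢j ∘ inj₂-injective ∘ from-injective split , outside i , outside j

  2≤outside : ∀ {u v} → P u ≡ false → P v ≡ false → u ≢ v → 2 ≤ b
  2≤outside Pu Pv u≢v = 2≤-of-≢ (index₂-≢ Pu Pv u≢v)

  3≤outside : ∀ {u v w} → P u ≡ false → P v ≡ false → P w ≡ false → u ≢ v → u ≢ w → v ≢ w → 3 ≤ b
  3≤outside Pu Pv Pw u≢v u≢w v≢w =
    3≤-of-≢ (index₂-≢ Pu Pv u≢v) (index₂-≢ Pu Pw u≢w) (index₂-≢ Pv Pw v≢w)

private
  consˡ : ∀ {n a} {B : Set} → Fin n ↔ (Fin a ⊎ B) → Fin (suc n) ↔ (Fin (suc a) ⊎ B)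
  consˡ {B = B} e = mk↔ₛ′ to′ from′ to∘from from∘to
    where
    open Inverse e
    to′ : Fin (suc _) → Fin (suc _) ⊎ B
    to′ zero    = inj₁ zero
    to′ (suc u) = Sum.map₁ suc (to u)
    from′ : Fin (suc _) ⊎ B → Fin (suc _)
    from′ (inj₁ zero)    = zero
    from′ (inj₁ (suc i)) = suc (from (inj₁ i))
    from′ (inj₂ j)       = suc (from (inj₂ j))
    from′-suc : ∀ x → from′ (Sum.map₁ suc x) ≡ suc (from x)
    from′-suc (inj₁ i) = refl
    from′-suc (inj₂ j) = refl
    to∘from : ∀ x → to′ (from′ x) ≡ x
    to∘from (inj₁ zero)    = refl
    to∘from (inj₁ (suc i)) = cong (Sum.map₁ suc) (strictlyInverseˡ (inj₁ i))
    to∘from (inj₂ j)       = cong (Sum.map₁ suc) (strictlyInverseˡ (inj₂ j))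
    from∘to : ∀ u → from′ (to′ u) ≡ u
    from∘to zero    = refl
    from∘to (suc u) = trans (from′-suc (to u)) (cong suc (strictlyInverseʳ u))

  consʳ : ∀ {n b} {A : Set} → Fin n ↔ (A ⊎ Fin b) → Fin (suc n) ↔ (A ⊎ Fin (suc b))
  consʳ e = ↔-trans (consˡ (↔-trans e (⊎-comm _ _))) (⊎-comm _ _)

partition : ∀ {n} (P : Fin n → Bool) → Partition P (count P) (count (not ∘ P))
partition {zero} P = record
  { split   = mk↔ₛ′ (λ ()) (λ { (inj₁ ()) ; (inj₂ ()) }) (λ { (inj₁ ()) ; (inj₂ ()) }) (λ ())
  ; inside  = λ ()
  ; outside = λ ()
  }
partition {suc n} P with P zero in P0 | partition (P ∘ suc)
... | true  | record { split = e ; inside = ins ; outside = out } = record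
  { split = consˡ e ; inside = λ { zero → P0 ; (suc i) → ins i } ; outside = out }
... | false | record { split = e ; inside = ins ; outside = out } = record
  { split = consʳ e ; inside = ins ; outside = λ { zero → P0 ; (suc j) → out j } }

≅-refl : ∀ {n} {G : Graph n} → G ≅ G
≅-refl = record { bij = ↔-refl ; pres = λ _ _ → refl }

≅-sym : ∀ {n m} {G : Graph n} {H : Graph m} → G ≅ H → H ≅ G
≅-sym {H = H} φ = record
  { bij  = ↔-sym (bij φ)
  ; pres = λ u v → ≡.sym (trans (≡.sym (cong₂ (adj H) (strictlyInverseˡ u) (strictlyInverseˡ v))) (pres φ _ _))
  }
  where open Inverse (bij φ)

≅-trans : ∀ {n m k} {G : Graph n} {H : Graph m} {J : Graph k} → G ≅ H → H ≅ J → G ≅ J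
≅-trans φ ψ = record { bij = ↔-trans (bij φ) (bij ψ) ; pres = λ u v → trans (pres ψ _ _) (pres φ u v) }

≅⇒≡ : ∀ {n m} {G : Graph n} {H : Graph m} → G ≅ H → n ≡ m
≅⇒≡ {n} {m} φ = decidable-stable (n ℕ.≟ m) (λ n≢m → refute n≢m (bij φ))

induced : ∀ {n k} → Graph n → (Fin k → Fin n) → Graph k
induced G f = record
  { adj    = λ i j → adj G (f i) (f j)
  ; sym    = λ i j → sym G (f i) (f j)
  ; irrefl = λ i → irrefl G (f i)
  }

≅-K : ∀ {n} {G : Graph n} → (∀ u v → u ≢ v → adj G u v ≡ true) → G ≅ K n
≅-K {G = G} adjacent = record { bij = ↔-refl ; pres = pres′ }
  where
  pres′ : ∀ u v → not (does (u ≟ v)) ≡ adj G u v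
  pres′ u v with u ≟ v
  ... | yes refl = ≡.sym (irrefl G u)
  ... | no u≢v   = ≡.sym (adjacent u v u≢v)

K-adj : ∀ {k} {i j : Fin k} → i ≢ j → adj (K k) i j ≡ true
K-adj {i = i} {j} i≢j = cong not (dec-false (i ≟ j) i≢j)

≅-E : ∀ {n} {G : Graph n} → (∀ u v → u ≢ v → adj G u v ≡ false) → G ≅ E n
≅-E {G = G} nonadjacent = record { bij = ↔-refl ; pres = pres′ }
  where
  pres′ : ∀ u v → false ≡ adj G u v
  pres′ u v with u ≟ v
  ... | yes refl = ≡.sym (irrefl G u)
  ... | no u≢v   = ≡.sym (nonadjacent u v u≢v)

≅-sumGraph : ∀ {n a b c} {G : Graph n} {H₁ : Graph a} {H₂ : Graph b} (e : Fin n ↔ (Fin a ⊎ Fin b)) →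
             (∀ u v → sumAdj c H₁ H₂ (Inverse.to e u) (Inverse.to e v) ≡ adj G u v) →
             G ≅ sumGraph c H₁ H₂
≅-sumGraph {a = a} {b} {c} {H₁ = H₁} {H₂} e pres′ = record
  { bij  = ↔-trans e (↔-sym +↔⊎)
  ; pres =
    λ u v → trans (cong₂ (sumAdj c H₁ H₂) (splitAt-join a b (Inverse.to e u)) (splitAt-join a b (Inverse.to e v)))
                  (pres′ u v)
  }

sumGraph-cong : ∀ {a a′ b b′ c} {G : Graph a} {G′ : Graph a′} {H : Graph b} {H′ : Graph b′} →
                G ≅ G′ → H ≅ H′ → sumGraph c G H ≅ sumGraph c G′ H′
sumGraph-cong {a} {c = c} {G} {G′} {H} {H′} φ ψ =
  ≅-sumGraph (↔-trans +↔⊎ (bij φ ⊎-↔ bij ψ)) λ u v → pres⊎ (splitAt a u) (splitAt a v)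
  where
  pres⊎ : ∀ x y → sumAdj c G′ H′ (Sum.map (Inverse.to (bij φ)) (Inverse.to (bij ψ)) x)
                                   (Sum.map (Inverse.to (bij φ)) (Inverse.to (bij ψ)) y) ≡ sumAdj c G H x y
  pres⊎ (inj₁ i) (inj₁ j) = pres φ i j
  pres⊎ (inj₁ i) (inj₂ j) = refl
  pres⊎ (inj₂ i) (inj₁ j) = refl
  pres⊎ (inj₂ i) (inj₂ j) = pres ψ i j

sumGraph-comm : ∀ {a b c} {G : Graph a} {H : Graph b} → sumGraph c G H ≅ sumGraph c H G
sumGraph-comm {a} {c = c} {G} {H} =
  ≅-sumGraph {H₁ = H} {H₂ = G} (↔-trans +↔⊎ (⊎-comm _ _)) λ u v → pres⊎ (splitAt a u) (splitAt a v)
  where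
  pres⊎ : ∀ x y → sumAdj c H G (Sum.swap x) (Sum.swap y) ≡ sumAdj c G H x y
  pres⊎ (inj₁ i) (inj₁ j) = refl
  pres⊎ (inj₁ i) (inj₂ j) = refl
  pres⊎ (inj₂ i) (inj₁ j) = refl
  pres⊎ (inj₂ i) (inj₂ j) = refl

≅-partition : ∀ {n a b} {G : Graph n} {P : Fin n → Bool} (c : Bool) (π : Partition P a b) →
              (∀ u v → P u ≡ true → P v ≡ false → adj G u v ≡ c) →
              G ≅ sumGraph c (induced G (Partition.from π ∘ inj₁)) (induced G (Partition.from π ∘ inj₂))
≅-partition {G = G} c π cross = ≅-sumGraph split λ u v →
  trans (pres⊎ (to u) (to v)) (cong₂ (adj G) (strictlyInverseʳ u) (strictlyInverseʳ v))
  where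
  open Partition π
  pres⊎ : ∀ x y → sumAdj c (induced G (from ∘ inj₁)) (induced G (from ∘ inj₂)) x y ≡ adj G (from x) (from y)
  pres⊎ (inj₁ i) (inj₁ j) = refl
  pres⊎ (inj₁ i) (inj₂ j) = ≡.sym (cross _ _ (inside i) (outside j))
  pres⊎ (inj₂ i) (inj₁ j) = ≡.sym (trans (sym G _ _) (cross _ _ (inside j) (outside i)))
  pres⊎ (inj₂ i) (inj₂ j) = refl

≅-K∪K₁ : ∀ {k} {G : Graph k} (c : Fin k) → (∀ v → adj G c v ≡ false) →
         (∀ u v → u ≢ c → v ≢ c → u ≢ v → adj G u v ≡ true) → G ≅ (K (k ∸ 1) ∪ᴳ K 1)
≅-K∪K₁ {suc t} {G} c isolated adjacent =
  ≅-sumGraph (mk↔ₛ′ to′ from′ to∘from from∘to) λ u v → pres′ (u ≟ c) (v ≟ c)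
  where
  detach : ∀ {u} → Dec (u ≡ c) → Fin t ⊎ Fin 1
  detach (yes _)  = inj₂ zero
  detach (no u≢c) = inj₁ (punchOut (≢-sym u≢c))

  to′ : Fin (suc t) → Fin t ⊎ Fin 1
  to′ u = detach (u ≟ c)

  from′ : Fin t ⊎ Fin 1 → Fin (suc t)
  from′ (inj₁ i)    = punchIn c i
  from′ (inj₂ zero) = c

  to∘from : ∀ x → to′ (from′ x) ≡ x
  to∘from (inj₁ i)    = detach-punchIn (punchIn c i ≟ c)
    where
    detach-punchIn : (d : Dec (punchIn c i ≡ c)) → detach d ≡ inj₁ i
    detach-punchIn (yes p) = contradiction p (punchInᵢ≢i c i)
    detach-punchIn (no _)  = cong inj₁ (trans (punchOut-cong c refl) (punchOut-punchIn c))
  to∘from (inj₂ zero) with c ≟ c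
  ... | yes _   = refl
  ... | no c≢c = contradiction refl c≢c

  from∘to : ∀ u → from′ (to′ u) ≡ u
  from∘to u = from-detach (u ≟ c)
    where
    from-detach : (d : Dec (u ≡ c)) → from′ (detach d) ≡ u
    from-detach (yes u≡c) = ≡.sym u≡c
    from-detach (no u≢c)  = punchIn-punchOut _

  pres′ : ∀ {u v} (du : Dec (u ≡ c)) (dv : Dec (v ≡ c)) → sumAdj false (K t) (K 1) (detach du) (detach dv) ≡ adj G u v
  pres′ (yes refl) (yes refl) = ≡.sym (irrefl G c)
  pres′ (yes refl) (no _)     = ≡.sym (isolated _)
  pres′ (no _)     (yes refl) = ≡.sym (trans (sym G _ c) (isolated _))
  pres′ {u} {v} (no u≢c) (no v≢c) with punchOut (≢-sym u≢c) ≟ punchOut (≢-sym v≢c)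
  ... | yes eq = ≡.sym (trans (cong (adj G u) (≡.sym (punchOut-injective (≢-sym u≢c) (≢-sym v≢c) eq))) (irrefl G u))
  ... | no neq = ≡.sym (adjacent u v u≢c v≢c λ { refl → neq (punchOut-cong c refl) })

module _ {n} (G : Graph n) where

  walk? : ∀ k u v → Dec (Walk G u v k)
  walk? zero u v with u ≟ v
  ... | yes refl = yes here
  ... | no u≢v   = no λ { here → u≢v refl }
  walk? (suc k) u v with any? (λ w → (adj G u w Bool.≟ true) ×-dec walk? k w v)
  ... | yes (w , uw , wv) = yes (step uw wv)
  ... | no ¬step          = no λ { (step uw wv) → ¬step (_ , uw , wv) }

  private
    shortest-from : ∀ {u v} j r → (∀ i → i < j → ¬ Walk G u v i) → Walk G u v (j + r) → ∃ (Dist G u v)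
    shortest-from {u} {v} j r shorter w with walk? j u v
    ... | yes wⱼ = j , wⱼ , λ i wᵢ → ℕ.≮⇒≥ λ i<j → shorter i i<j wᵢ
    shortest-from {u} {v} j zero    shorter w | no ¬wⱼ = contradiction (≡.subst (Walk G u v) (ℕ.+-identityʳ j) w) ¬wⱼ
    shortest-from {u} {v} j (suc r) shorter w | no ¬wⱼ =
      shortest-from (suc j) r shorter′ (≡.subst (Walk G u v) (ℕ.+-suc j r) w)
      where
      shorter′ : ∀ i → i < suc j → ¬ Walk G u v i
      shorter′ i i<1+j with ℕ.m<1+n⇒m<n∨m≡n i<1+j
      ... | inj₁ i<j  = shorter i i<j
      ... | inj₂ refl = ¬wⱼ

  walk⇒Dist : ∀ {u v k} → Walk G u v k → ∃ (Dist G u v)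
  walk⇒Dist {k = k} = shortest-from 0 k λ _ ()

  Dist-unique : ∀ {u v d₁ d₂} → Dist G u v d₁ → Dist G u v d₂ → d₁ ≡ d₂
  Dist-unique (w₁ , min₁) (w₂ , min₂) = ℕ.≤-antisym (min₁ _ w₂) (min₂ _ w₁)

  Dist-refl : ∀ u → Dist G u u 0
  Dist-refl u = here , λ _ _ → z≤n

  Dist-zero⇒≡ : ∀ {u v} → Dist G u v 0 → u ≡ v
  Dist-zero⇒≡ (here , _) = refl

  Dist-one⇒adj : ∀ {u v} → Dist G u v 1 → adj G u v ≡ true
  Dist-one⇒adj (step uv here , _) = uv

  adj⇒Dist-one : ∀ {u v} → adj G u v ≡ true → Dist G u v 1
  adj⇒Dist-one {u} uv =
    step uv here , λ { zero here → contradiction (trans (≡.sym uv) (irrefl G u)) λ () ; (suc _) _ → s≤s z≤n }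

  Dist-suc : ∀ {u v d} → Dist G u v (suc d) → Σ (Fin n) λ w → adj G u w ≡ true × Dist G w v d
  Dist-suc (step uw wv , min) = _ , uw , wv , λ k w → ℕ.≤-pred (min (suc k) (step uw w))

  Dist-≤ : ∀ {u v d j} → Dist G u v d → j ≤ d → Σ (Fin n) λ w → Dist G w v j
  Dist-≤ {u} D j≤d with ℕ.m≤n⇒m<n∨m≡n j≤d
  Dist-≤ {u}           D _ | inj₂ refl       = u , D
  Dist-≤ {d = suc _} D _ | inj₁ (s≤s j≤d) = Dist-≤ (proj₂ (proj₂ (Dist-suc D))) j≤d

Twins : ∀ {n} → Graph n → Fin n → Fin n → Set
Twins G x y = ∀ z → z ≢ x → z ≢ y → adj G x z ≡ adj G y z

module TwinProperties {n} (G : Graph n) where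

  private
    agree? : ∀ x y z → Dec (z ≢ x → z ≢ y → adj G x z ≡ adj G y z)
    agree? x y z = ¬? (z ≟ x) →-dec ¬? (z ≟ y) →-dec (adj G x z Bool.≟ adj G y z)

  Twins? : ∀ x y → Dec (Twins G x y)
  Twins? x y = all? (agree? x y)

  separator : ∀ {x y} → ¬ Twins G x y → Σ (Fin n) λ z → z ≢ x × z ≢ y × adj G x z ≢ adj G y z
  separator {x} {y} ¬x∼y with ¬∀⟶∃¬ n _ (agree? x y) ¬x∼y
  ... | z , disagree = z , (λ z≡x → disagree λ z≢x → contradiction z≡x z≢x)
                         , (λ z≡y → disagree λ _ z≢y → contradiction z≡y z≢y)
                         , (λ xz≡yz → disagree λ _ _ → xz≡yz)

  Twins-refl : ∀ {x} → Twins G x x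
  Twins-refl _ _ _ = refl

  Twins-sym : ∀ {x y} → Twins G x y → Twins G y x
  Twins-sym x∼y z z≢y z≢x = ≡.sym (x∼y z z≢x z≢y)

  Twins-trans : ∀ {x y z} → Twins G x y → Twins G y z → Twins G x z
  Twins-trans {x} {y} {z} x∼y y∼z w w≢x w≢z with w ≟ y
  ... | no w≢y    = trans (x∼y w w≢x w≢y) (y∼z w w≢y w≢z)
  ... | yes refl with x ≟ z
  ...   | yes refl = refl
  ...   | no x≢z   = begin
    adj G x w  ≡⟨ sym G x w ⟩
    adj G w x  ≡⟨ y∼z x (≢-sym w≢x) x≢z ⟩
    adj G z x  ≡⟨ sym G z x ⟩
    adj G x z  ≡⟨ x∼y z (≢-sym x≢z) (≢-sym w≢z) ⟩
    adj G w z  ≡⟨ sym G w z ⟩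
    adj G z w  ∎
    where open ≡.≡-Reasoning

  Twins-≢ : ∀ {x y} → ¬ Twins G x y → x ≢ y
  Twins-≢ ¬x∼y refl = ¬x∼y Twins-refl

  Twins-adj : ∀ {x x′ y y′} → Twins G x x′ → Twins G y y′ → ¬ Twins G x y → adj G x y ≡ adj G x′ y′
  Twins-adj {x} {x′} {y} {y′} x∼x′ y∼y′ ¬x∼y = begin
    adj G x y    ≡⟨ x∼x′ y (≢-sym (Twins-≢ ¬x∼y)) y≢x′ ⟩
    adj G x′ y   ≡⟨ sym G x′ y ⟩
    adj G y x′   ≡⟨ y∼y′ x′ (≢-sym y≢x′) x′≢y′ ⟩
    adj G y′ x′  ≡⟨ sym G y′ x′ ⟩
    adj G x′ y′  ∎
    where
    open ≡.≡-Reasoning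
    y≢x′ : y ≢ x′
    y≢x′ refl = ¬x∼y x∼x′
    x′≢y′ : x′ ≢ y′
    x′≢y′ refl = ¬x∼y (Twins-trans x∼x′ (Twins-sym y∼y′))

  Twins-adj-within : ∀ {x x′ y y′} → Twins G x x′ → Twins G x y → Twins G x y′ → x ≢ x′ → y ≢ y′ →
                     adj G x x′ ≡ adj G y y′
  Twins-adj-within {x} {x′} {y} {y′} x∼x′ x∼y x∼y′ x≢x′ y≢y′ with y ≟ x′
  ... | no y≢x′ = begin
    adj G x x′   ≡⟨ x∼y x′ (≢-sym x≢x′) (≢-sym y≢x′) ⟩
    adj G y x′   ≡⟨ sym G y x′ ⟩
    adj G x′ y   ≡⟨ Twins-trans (Twins-sym x∼x′) x∼y′ y y≢x′ y≢y′ ⟩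
    adj G y′ y   ≡⟨ sym G y′ y ⟩
    adj G y y′   ∎
    where open ≡.≡-Reasoning
  ... | yes refl with y′ ≟ x
  ...   | yes refl = sym G x y
  ...   | no y′≢x  = trans (x∼y′ y (≢-sym x≢x′) y≢y′) (sym G y′ y)

  Uniform : Fin n → Bool → Set
  Uniform r α = ∀ {x y} → Twins G r x → Twins G r y → x ≢ y → adj G x y ≡ α

  twin-class-uniform : ∀ r → Σ Bool (Uniform r)
  twin-class-uniform r with any? (λ x → Twins? r x ×-dec ¬? (x ≟ r))
  ... | yes (x₀ , r∼x₀ , x₀≢r) =
    adj G r x₀ , λ r∼x r∼y x≢y → ≡.sym (Twins-adj-within r∼x₀ r∼x r∼y (≢-sym x₀≢r) x≢y)
  ... | no singleton = false , λ {x} {y} r∼x r∼y x≢y → ⊥-elim (alone r∼x r∼y x≢y)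
    where
    alone : ∀ {x y} → Twins G r x → Twins G r y → x ≢ y → ⊥
    alone {x} {y} r∼x r∼y x≢y with x ≟ r
    ... | yes refl = singleton (y , r∼y , ≢-sym x≢y)
    ... | no x≢r   = singleton (x , r∼x , x≢r)

  clique-class : ∀ {r} → (∀ {w} → Twins G r w → w ≢ r → adj G r w ≡ true) → Uniform r true
  clique-class {r} centre {x} {y} r∼x r∼y x≢y with x ≟ r
  ... | yes refl = centre r∼y (≢-sym x≢y)
  ... | no x≢r   = trans (≡.sym (Twins-adj-within r∼x r∼x r∼y (≢-sym x≢r) x≢y)) (centre r∼x x≢r)

-- Graphs of metric dimension n − 2

Resolves : ∀ {n} → Graph n → Fin n → Fin n → Fin n → Set
Resolves G x y s = Σ ℕ λ d₁ → Σ ℕ λ d₂ → Dist G x s d₁ × Dist G y s d₂ × d₁ ≢ d₂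

Resolves-sym : ∀ {n} {G : Graph n} {x y s} → Resolves G x y s → Resolves G y x s
Resolves-sym (d₁ , d₂ , D₁ , D₂ , d₁≢d₂) = d₂ , d₁ , D₂ , D₁ , ≢-sym d₁≢d₂

∣tabulate∣≡count : ∀ {n} (P : Fin n → Bool) → ∣ tabulate P ∣ ≡ count P
∣tabulate∣≡count {zero}  P = refl
∣tabulate∣≡count {suc n} P with P zero
... | true  = cong suc (∣tabulate∣≡count (P ∘ suc))
... | false = ∣tabulate∣≡count (P ∘ suc)

adj-≢ : ∀ {n} (G : Graph n) {x y z} → adj G x z ≢ adj G y z → x ≢ y
adj-≢ G x≁y refl = x≁y refl

adj⇒≢ : ∀ {n} (G : Graph n) {x y} → adj G x y ≡ true → x ≢ y
adj⇒≢ G {x} xy refl = contradiction (trans (≡.sym xy) (irrefl G x)) λ ()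

data Shape {n} (G : Graph n) : Set where
  ≅Kbip   : ∀ a b → b ≤ a → G ≅ Kbip a b → Shape G
  ≅K+E    : ∀ a b → 2 ≤ b → G ≅ (K a +ᴳ E b) → Shape G
  ≅K+K∪K₁ : ∀ s t → 2 ≤ t → G ≅ (K s +ᴳ (K t ∪ᴳ K 1)) → Shape G

module Dim≡n∸2 {n} {G : Graph n} (connected : Connected G) {m} (dim : IsMetricDim G m) (m+2≡n : m + 2 ≡ n) where

  open TwinProperties G

  distance : ∀ u v → ∃ (Dist G u v)
  distance u v = walk⇒Dist G (proj₂ (connected u v))

  self-resolves : ∀ {x y} → x ≢ y → Resolves G x y x
  self-resolves {x} {y} x≢y with distance y x
  ... | d , D = 0 , d , Dist-refl G x , D , λ { refl → x≢y (≡.sym (Dist-zero⇒≡ G D)) }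

  ResolvedOutside : Fin n → Fin n → Fin n → Fin n → Fin n → Set
  ResolvedOutside a b c x y = Σ (Fin n) λ z → z ≢ a × z ≢ b × z ≢ c × Resolves G x y z

  -- V ∖ {a, b, c} would be a resolving set of size n − 3.
  no-three-resolved-outside : ∀ {a b c} → a ≢ b → a ≢ c → b ≢ c →
    ResolvedOutside a b c a b → ResolvedOutside a b c a c → ResolvedOutside a b c b c → ⊥
  no-three-resolved-outside {a} {b} {c} a≢b a≢c b≢c ab ac bc =
    contradiction (ℕ.+-cancelˡ-≤ m 3 2 m+3≤m+2) λ { (s≤s (s≤s ())) }
    where
    outside? : ∀ z → Dec (z ≢ a × z ≢ b × z ≢ c)
    outside? z = ¬? (z ≟ a) ×-dec ¬? (z ≟ b) ×-dec ¬? (z ≟ c)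
    P : Fin n → Bool
    P z = does (outside? z)
    inside : ∀ {z} → z ≡ a ⊎ z ≡ b ⊎ z ≡ c → P z ≡ false
    inside z∈abc = dec-false (outside? _) λ { (z≢a , z≢b , z≢c) → [ z≢a , [ z≢b , z≢c ]′ ]′ z∈abc }
    S = tabulate P
    ∈S : ∀ {z} → z ≢ a × z ≢ b × z ≢ c → z ∈ S
    ∈S {z} z∉abc = lookup⇒[]= z S (trans (lookup∘tabulate P z) (dec-true (outside? z) z∉abc))
    locate : ∀ z → z ≡ a ⊎ z ≡ b ⊎ z ≡ c ⊎ (z ≢ a × z ≢ b × z ≢ c)
    locate z with z ≟ a | z ≟ b | z ≟ c
    ... | yes z≡a | _       | _       = inj₁ z≡a
    ... | no _    | yes z≡b | _       = inj₂ (inj₁ z≡b)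
    ... | no _    | no _    | yes z≡c = inj₂ (inj₂ (inj₁ z≡c))
    ... | no z≢a  | no z≢b  | no z≢c  = inj₂ (inj₂ (inj₂ (z≢a , z≢b , z≢c)))
    outside⇒S : ∀ {x y} → ResolvedOutside a b c x y → Σ (Fin n) λ s → s ∈ S × Resolves G x y s
    outside⇒S (z , z≢a , z≢b , z≢c , r) = z , ∈S (z≢a , z≢b , z≢c) , r
    outside⇒S-sym : ∀ {x y} → ResolvedOutside a b c x y → Σ (Fin n) λ s → s ∈ S × Resolves G y x s
    outside⇒S-sym (z , z≢a , z≢b , z≢c , r) = outside⇒S (z , z≢a , z≢b , z≢c , Resolves-sym r)
    resolving : Resolving G S
    resolving g₁ g₂ g₁≢g₂ with locate g₁ | locate g₂
    ... | inj₂ (inj₂ (inj₂ g₁∉abc)) | _ = g₁ , ∈S g₁∉abc , self-resolves g₁≢g₂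
    ... | _ | inj₂ (inj₂ (inj₂ g₂∉abc)) = g₂ , ∈S g₂∉abc , Resolves-sym (self-resolves (≢-sym g₁≢g₂))
    ... | inj₁ refl               | inj₁ refl               = contradiction refl g₁≢g₂
    ... | inj₁ refl               | inj₂ (inj₁ refl)        = outside⇒S ab
    ... | inj₁ refl               | inj₂ (inj₂ (inj₁ refl)) = outside⇒S ac
    ... | inj₂ (inj₁ refl)        | inj₁ refl               = outside⇒S-sym ab
    ... | inj₂ (inj₁ refl)        | inj₂ (inj₁ refl)        = contradiction refl g₁≢g₂
    ... | inj₂ (inj₁ refl)        | inj₂ (inj₂ (inj₁ refl)) = outside⇒S bc
    ... | inj₂ (inj₂ (inj₁ refl)) | inj₁ refl               = outside⇒S-sym ac
    ... | inj₂ (inj₂ (inj₁ refl)) | inj₂ (inj₁ refl)        = outside⇒S-sym bc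
    ... | inj₂ (inj₂ (inj₁ refl)) | inj₂ (inj₂ (inj₁ refl)) = contradiction refl g₁≢g₂
    m≤∣S∣ : m ≤ count P
    m≤∣S∣ = ≡.subst (m ≤_) (∣tabulate∣≡count P) (proj₂ dim S resolving)
    3≤∣abc∣ : 3 ≤ count (not ∘ P)
    3≤∣abc∣ = Partition.3≤outside (partition P) (inside (inj₁ refl)) (inside (inj₂ (inj₁ refl)))
                (inside (inj₂ (inj₂ refl))) a≢b a≢c b≢c
    m+3≤m+2 : m + 3 ≤ m + 2
    m+3≤m+2 = ≡.subst (m + 3 ≤_) (trans (count-complement P) (≡.sym m+2≡n)) (ℕ.+-mono-≤ m≤∣S∣ 3≤∣abc∣)

  no-distance-three : ∀ {u v} → ¬ Dist G u v 3
  no-distance-three {u} {v} D₃ with Dist-suc G D₃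
  ... | b , _ , D₂ with Dist-suc G D₂
  ... | c , _ , D₁ = no-three-resolved-outside (≢-at D₃ D₂ λ ()) (≢-at D₃ D₁ λ ()) (≢-at D₂ D₁ λ ())
                       (v , v≢ D₃ , v≢ D₂ , v≢ D₁ , 3 , 2 , D₃ , D₂ , λ ())
                       (v , v≢ D₃ , v≢ D₂ , v≢ D₁ , 3 , 1 , D₃ , D₁ , λ ())
                       (v , v≢ D₃ , v≢ D₂ , v≢ D₁ , 2 , 1 , D₂ , D₁ , λ ())
    where
    ≢-at : ∀ {x y d₁ d₂} → Dist G x v d₁ → Dist G y v d₂ → d₁ ≢ d₂ → x ≢ y
    ≢-at D D′ d₁≢d₂ refl = d₁≢d₂ (Dist-unique G D D′)
    v≢ : ∀ {x d} → Dist G x v (suc d) → v ≢ x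
    v≢ D refl = ≢-at D (Dist-refl G v) (λ ()) refl

  diameter≤2 : ∀ {u v d} → Dist G u v d → d ≤ 2
  diameter≤2 {d = d} D with d ℕ.≤? 2
  ... | yes d≤2 = d≤2
  ... | no d≰2  = contradiction (proj₂ (Dist-≤ G D (ℕ.≰⇒> d≰2))) no-distance-three

  hops : Bool → ℕ
  hops true  = 1
  hops false = 2

  hops-injective : ∀ {α β} → hops α ≡ hops β → α ≡ β
  hops-injective {true}  {true}  _ = refl
  hops-injective {false} {false} _ = refl

  Dist-adj : ∀ {x z} → x ≢ z → Dist G x z (hops (adj G x z))
  Dist-adj {x} {z} x≢z with adj G x z in xz | distance x z
  ... | true  | _                   = adj⇒Dist-one G xz
  ... | false | zero , D            = contradiction (Dist-zero⇒≡ G D) x≢z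
  ... | false | suc zero , D        = contradiction (trans (≡.sym xz) (Dist-one⇒adj G D)) λ ()
  ... | false | suc (suc zero) , D  = D
  ... | false | suc (suc (suc _)) , D = contradiction (diameter≤2 D) λ { (s≤s (s≤s ())) }

  adj-resolves : ∀ {x y z} → x ≢ z → y ≢ z → adj G x z ≢ adj G y z → Resolves G x y z
  adj-resolves x≢z y≢z x≁y = _ , _ , Dist-adj x≢z , Dist-adj y≢z , x≁y ∘ hops-injective

  common-neighbour : ∀ {u v} → u ≢ v → adj G u v ≡ false → Σ (Fin n) λ w → adj G u w ≡ true × adj G w v ≡ true
  common-neighbour {u} {v} u≢v uv with Dist-suc G (≡.subst (Dist G u v ∘ hops) uv (Dist-adj u≢v))
  ... | w , uw , D = w , uw , Dist-one⇒adj G D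

  twins-meet-resolving : ∀ {S} → Resolving G S → ∀ {x y} → x ≢ y → Twins G x y → x ∈ S ⊎ y ∈ S
  twins-meet-resolving res {x} {y} x≢y x∼y with res x y x≢y
  ... | s , s∈S , d₁ , d₂ , D₁ , D₂ , d₁≢d₂ with s ≟ x | s ≟ y
  ...   | yes refl | _        = inj₁ s∈S
  ...   | no _     | yes refl = inj₂ s∈S
  ...   | no s≢x   | no s≢y   = contradiction (begin
    d₁                 ≡⟨ Dist-unique G D₁ (Dist-adj (≢-sym s≢x)) ⟩
    hops (adj G x s)   ≡⟨ cong hops (x∼y s s≢x s≢y) ⟩
    hops (adj G y s)   ≡⟨ Dist-unique G (Dist-adj (≢-sym s≢y)) D₂ ⟩
    d₂                 ∎) d₁≢d₂
    where open ≡.≡-Reasoning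

  complement-of-basis : ∀ {S} → ∣ S ∣ ≡ m → count (not ∘ lookup S) ≡ 2
  complement-of-basis {S} ∣S∣≡m = ℕ.+-cancelˡ-≡ (count P) _ _ (begin
    count P + count (not ∘ P)  ≡⟨ count-complement P ⟩
    n                          ≡⟨ m+2≡n ⟨
    m + 2                      ≡⟨ cong (_+ 2) m≡count ⟩
    count P + 2                ∎)
    where
    open ≡.≡-Reasoning
    P = lookup S
    m≡count : m ≡ count P
    m≡count = trans (≡.sym ∣S∣≡m) (trans (cong ∣_∣ (≡.sym (tabulate∘lookup S))) (∣tabulate∣≡count P))

  -- The two vertices outside a metric basis are not twins.
  non-twins : Σ (Fin n) λ x → Σ (Fin n) λ y → ¬ Twins G x y
  non-twins with proj₁ dim
  ... | S , res , ∣S∣≡m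
    with Partition.outside-pair (partition (lookup S)) (ℕ.≤-reflexive (≡.sym (complement-of-basis {S} ∣S∣≡m)))
  ...   | x , y , x≢y , Sx , Sy = x , y , λ x∼y → [ ∉S Sx , ∉S Sy ]′ (twins-meet-resolving res x≢y x∼y)
    where
    ∉S : ∀ {v} → lookup S v ≡ false → v ∉ S
    ∉S Sv v∈S = contradiction (trans (≡.sym ([]=⇒lookup v∈S)) Sv) λ ()

  TwinsOutside : Fin n → Fin n → Fin n → Set
  TwinsOutside x y c = ∀ z → z ≢ x → z ≢ y → z ≢ c → adj G x z ≡ adj G y z

  private
    agree-outside? : ∀ x y c z → Dec (z ≢ x → z ≢ y → z ≢ c → adj G x z ≡ adj G y z)
    agree-outside? x y c z = ¬? (z ≟ x) →-dec ¬? (z ≟ y) →-dec ¬? (z ≟ c) →-dec (adj G x z Bool.≟ adj G y z)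

  resolved-outside : ∀ {x y c} → ¬ TwinsOutside x y c → Σ (Fin n) λ z → z ≢ x × z ≢ y × z ≢ c × Resolves G x y z
  resolved-outside {x} {y} {c} ¬x∼y with ¬∀⟶∃¬ n _ (agree-outside? x y c) ¬x∼y
  ... | z , disagree = z , z≢x , z≢y , (λ z≡c → disagree λ _ _ z≢c → contradiction z≡c z≢c)
                         , adj-resolves (≢-sym z≢x) (≢-sym z≢y) λ xz≡yz → disagree λ _ _ _ → xz≡yz
    where
    z≢x : z ≢ x
    z≢x z≡x = disagree λ z≢x → contradiction z≡x z≢x
    z≢y : z ≢ y
    z≢y z≡y = disagree λ _ z≢y → contradiction z≡y z≢y

  twins-outside-third : ∀ {a b c} → a ≢ b → a ≢ c → b ≢ c →
                        TwinsOutside a b c ⊎ TwinsOutside a c b ⊎ TwinsOutside b c a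
  twins-outside-third {a} {b} {c} a≢b a≢c b≢c
    with all? (agree-outside? a b c) | all? (agree-outside? a c b) | all? (agree-outside? b c a)
  ... | yes ab∼ | _      | _      = inj₁ ab∼
  ... | no _    | yes ac∼ | _     = inj₂ (inj₁ ac∼)
  ... | no _    | no _   | yes bc∼ = inj₂ (inj₂ bc∼)
  ... | no ¬ab∼ | no ¬ac∼ | no ¬bc∼
    with resolved-outside ¬ab∼ | resolved-outside ¬ac∼ | resolved-outside ¬bc∼
  ...   | z₁ , z₁≢a , z₁≢b , z₁≢c , r₁ | z₂ , z₂≢a , z₂≢c , z₂≢b , r₂ | z₃ , z₃≢b , z₃≢c , z₃≢a , r₃ =
    ⊥-elim (no-three-resolved-outside a≢b a≢c b≢c (z₁ , z₁≢a , z₁≢b , z₁≢c , r₁)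
                                                   (z₂ , z₂≢a , z₂≢b , z₂≢c , r₂)
                                                   (z₃ , z₃≢a , z₃≢b , z₃≢c , r₃))

  OnlySeparator : Fin n → Fin n → Fin n → Set
  OnlySeparator x y c = TwinsOutside x y c × adj G x c ≢ adj G y c

  only-separator : ∀ {x y c} → TwinsOutside x y c → ¬ Twins G x y → OnlySeparator x y c
  only-separator {x} {y} {c} x∼y ¬x∼y = x∼y , λ xc≡yc → ¬x∼y λ z z≢x z≢y → agree-at z xc≡yc z≢x z≢y
    where
    agree-at : ∀ z → adj G x c ≡ adj G y c → z ≢ x → z ≢ y → adj G x z ≡ adj G y z
    agree-at z xc≡yc z≢x z≢y with z ≟ c
    ... | yes refl = xc≡yc
    ... | no z≢c   = x∼y z z≢x z≢y z≢c

  OnlySeparator-sym : ∀ {x y c} → OnlySeparator x y c → OnlySeparator y x c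
  OnlySeparator-sym (x∼y , xc≢yc) = (λ z z≢y z≢x z≢c → ≡.sym (x∼y z z≢x z≢y z≢c)) , ≢-sym xc≢yc

  private
    resolved-by : ∀ {a b c x y} z → z ≢ a → z ≢ b → z ≢ c → adj G x z ≢ adj G y z → x ≢ z → y ≢ z →
                  ResolvedOutside a b c x y
    resolved-by z z≢a z≢b z≢c x≁y x≢z y≢z = z , z≢a , z≢b , z≢c , adj-resolves x≢z y≢z x≁y

    -- a, b, c, d induce the path b a c d (x = true) or a d b c (x = false); its two ends and a
    -- common neighbour o of them form a triple all of whose pairs are resolved outside.
    induced-path : ∀ {a b c d} → a ≢ b → a ≢ c → a ≢ d → b ≢ c → b ≢ d → c ≢ d →
      TwinsOutside a b c → TwinsOutside a d b → TwinsOutside c d a →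
      ∀ x → adj G a b ≡ x → adj G a c ≡ x → adj G c d ≡ x →
            adj G a d ≡ not x → adj G b c ≡ not x → adj G b d ≡ not x → ⊥
    induced-path {a} {b} {c} {d} a≢b a≢c a≢d b≢c b≢d c≢d ab∼c ad∼b cd∼a true ab ac cd ad bc bd
      with common-neighbour b≢d bd
    ... | o , bo , od = no-three-resolved-outside b≢d b≢o d≢o
          (resolved-by a a≢b a≢d a≢o (T≢F (trans (sym G b a) ab) (trans (sym G d a) ad)) (≢-sym a≢b) (≢-sym a≢d))
          (resolved-by c (≢-sym b≢c) c≢d c≢o (≢-sym (T≢F (trans (sym G o c) co) bc)) b≢c o≢c)
          (resolved-by a a≢b a≢d a≢o (≢-sym (T≢F (trans (sym G o a) ao) (trans (sym G d a) ad))) (≢-sym a≢d) o≢a)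
      where
      b≢o = adj⇒≢ G bo
      d≢o = ≢-sym (adj⇒≢ G od)
      o≢a : o ≢ a
      o≢a = adj-≢ G (T≢F od ad)
      o≢c : o ≢ c
      o≢c = adj-≢ G (T≢F (trans (sym G o b) bo) (trans (sym G c b) bc))
      a≢o = ≢-sym o≢a
      c≢o = ≢-sym o≢c
      ao : adj G a o ≡ true
      ao = trans (ab∼c o o≢a (≢-sym b≢o) o≢c) bo
      co : adj G c o ≡ true
      co = trans (cd∼a o o≢c (≢-sym d≢o) o≢a) (trans (sym G d o) od)
    induced-path {a} {b} {c} {d} a≢b a≢c a≢d b≢c b≢d c≢d ab∼c ad∼b cd∼a false ab ac cd ad bc bd
      with common-neighbour a≢c ac
    ... | o , ao , oc = no-three-resolved-outside a≢c a≢o c≢o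
          (resolved-by b (≢-sym a≢b) b≢c b≢o (≢-sym (T≢F (trans (sym G c b) bc) ab)) a≢b (≢-sym b≢c))
          (resolved-by b (≢-sym a≢b) b≢c b≢o (≢-sym (T≢F (trans (sym G o b) bo) ab)) a≢b o≢b)
          (resolved-by d (≢-sym a≢d) (≢-sym c≢d) d≢o (≢-sym (T≢F od cd)) c≢d o≢d)
      where
      a≢o = adj⇒≢ G ao
      c≢o = ≢-sym (adj⇒≢ G oc)
      o≢b : o ≢ b
      o≢b = adj-≢ G (T≢F (trans (sym G o a) ao) (trans (sym G b a) ab))
      o≢d : o ≢ d
      o≢d = adj-≢ G (T≢F oc (trans (sym G d c) cd))
      b≢o = ≢-sym o≢b
      d≢o = ≢-sym o≢d
      bo : adj G b o ≡ true
      bo = trans (≡.sym (ab∼c o (≢-sym a≢o) o≢b (≢-sym c≢o))) ao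
      od : adj G o d ≡ true
      od = trans (sym G o d) (trans (≡.sym (ad∼b o (≢-sym a≢o) o≢d o≢b)) ao)

    four-non-twins-separated : ∀ {a b c d} → ¬ Twins G a b → ¬ Twins G a c → ¬ Twins G a d →
      ¬ Twins G b c → ¬ Twins G b d → ¬ Twins G c d → OnlySeparator a b c → OnlySeparator a d b → ⊥
    four-non-twins-separated {a} {b} {c} {d} ¬ab ¬ac ¬ad ¬bc ¬bd ¬cd (ab∼c , ac≢bc) (ad∼b , ab≢db)
      with twins-outside-third (Twins-≢ ¬ac) (Twins-≢ ¬ad) (Twins-≢ ¬cd)
    ... | inj₁ ac∼d = ad≢cd (trans (≡.sym ac≡ad) ac≡cd)
      where
      ad≢cd = proj₂ (only-separator ac∼d ¬ac)
      ac≡cd = trans (ad∼b c (≢-sym (Twins-≢ ¬ac)) (Twins-≢ ¬cd) (≢-sym (Twins-≢ ¬bc))) (sym G d c)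
      bc≡ab = trans (sym G b c) (≡.sym (ac∼d b (≢-sym (Twins-≢ ¬ab)) (Twins-≢ ¬bc) (Twins-≢ ¬bd)))
      bd≢ab : adj G b d ≢ adj G a b
      bd≢ab bd≡ab = ab≢db (trans (≡.sym bd≡ab) (sym G b d))
      ac≡ad = trans (¬-not ac≢bc) (trans (cong not bc≡ab) (≡.sym (trans ad≡bd (¬-not bd≢ab))))
        where ad≡bd = ab∼c d (≢-sym (Twins-≢ ¬ad)) (≢-sym (Twins-≢ ¬bd)) (≢-sym (Twins-≢ ¬cd))
    ... | inj₂ (inj₁ ad∼c) = ab≢db (ad∼c b (≢-sym (Twins-≢ ¬ab)) (Twins-≢ ¬bd) (Twins-≢ ¬bc))
    ... | inj₂ (inj₂ cd∼a) =
      induced-path a≢b a≢c a≢d b≢c b≢d c≢d ab∼c ad∼b cd∼a (adj G a c) ab≡ refl cd≡ ad≡ bc≡ bd≡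
      where
      a≢b = Twins-≢ ¬ab
      a≢c = Twins-≢ ¬ac
      a≢d = Twins-≢ ¬ad
      b≢c = Twins-≢ ¬bc
      b≢d = Twins-≢ ¬bd
      c≢d = Twins-≢ ¬cd
      bc≡ : adj G b c ≡ not (adj G a c)
      bc≡ = ¬-not (≢-sym ac≢bc)
      bd≡ : adj G b d ≡ not (adj G a c)
      bd≡ = trans (≡.sym (trans (sym G b c) (trans (cd∼a b b≢c b≢d (≢-sym a≢b)) (sym G d b)))) bc≡
      ad≡ : adj G a d ≡ not (adj G a c)
      ad≡ = trans (ab∼c d (≢-sym a≢d) (≢-sym b≢d) (≢-sym c≢d)) bd≡
      ab≡ : adj G a b ≡ adj G a c
      ab≡ = trans (¬-not λ ab≡bd → ab≢db (trans ab≡bd (sym G b d))) (trans (cong not bd≡) (not-involutive _))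
      cd≡ : adj G c d ≡ adj G a c
      cd≡ = ≡.sym (trans (ad∼b c (≢-sym a≢c) c≢d (≢-sym b≢c)) (sym G d c))

    four-non-twins-separated′ : ∀ {a b c d} → ¬ Twins G a b → ¬ Twins G a c → ¬ Twins G a d →
      ¬ Twins G b c → ¬ Twins G b d → ¬ Twins G c d → OnlySeparator a b c → ⊥
    four-non-twins-separated′ {a} {b} {c} {d} ¬ab ¬ac ¬ad ¬bc ¬bd ¬cd ab∣c@(_ , ac≢bc)
      with twins-outside-third (Twins-≢ ¬ab) (Twins-≢ ¬ad) (Twins-≢ ¬bd)
    ... | inj₁ ab∼d = ac≢bc (ab∼d c (≢-sym (Twins-≢ ¬ac)) (≢-sym (Twins-≢ ¬bc)) (Twins-≢ ¬cd))
    ... | inj₂ (inj₁ ad∼b) = four-non-twins-separated ¬ab ¬ac ¬ad ¬bc ¬bd ¬cd ab∣c (only-separator ad∼b ¬ad)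
    ... | inj₂ (inj₂ bd∼a) = four-non-twins-separated (¬ab ∘ Twins-sym) ¬bc ¬bd ¬ac ¬ad ¬cd
                               (OnlySeparator-sym ab∣c) (only-separator bd∼a ¬bd)

  four-non-twins : ∀ {a b c d} → ¬ Twins G a b → ¬ Twins G a c → ¬ Twins G a d →
                   ¬ Twins G b c → ¬ Twins G b d → ¬ Twins G c d → ⊥
  four-non-twins ¬ab ¬ac ¬ad ¬bc ¬bd ¬cd with twins-outside-third (Twins-≢ ¬ab) (Twins-≢ ¬ac) (Twins-≢ ¬bc)
  ... | inj₁ ab∼c        = four-non-twins-separated′ ¬ab ¬ac ¬ad ¬bc ¬bd ¬cd (only-separator ab∼c ¬ab)
  ... | inj₂ (inj₁ ac∼b) = four-non-twins-separated′ ¬ac ¬ab ¬ad (¬bc ∘ Twins-sym) ¬cd ¬bd (only-separator ac∼b ¬ac)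
  ... | inj₂ (inj₂ bc∼a) = four-non-twins-separated′ ¬bc (¬ab ∘ Twins-sym) ¬bd (¬ac ∘ Twins-sym) ¬cd ¬ad
                             (only-separator bc∼a ¬bc)

  private
    induced-uniform : ∀ {k r α} {f : Fin k → Fin n} → (∀ {i j} → f i ≡ f j → i ≡ j) → (∀ i → Twins G r (f i)) →
                      Uniform r α → ∀ i j → i ≢ j → adj (induced G f) i j ≡ α
    induced-uniform f-injective r∼f uniform i j i≢j = uniform (r∼f i) (r∼f j) (i≢j ∘ f-injective)

  module TwoClasses {r₁ r₂} (¬r₁∼r₂ : ¬ Twins G r₁ r₂) (cover : ∀ v → Twins G r₁ v ⊎ Twins G r₂ v) where

    private
      P : Fin n → Bool
      P v = does (Twins? r₁ v)
      π = partition P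
      open Partition π using (split; from; inside; outside; 2≤outside)

      class₁ : ∀ {v} → P v ≡ true → Twins G r₁ v
      class₁ {v} = does-true (Twins? r₁ v)

      class₂ : ∀ {v} → P v ≡ false → Twins G r₂ v
      class₂ {v} Pv = [ (λ r₁∼v → contradiction r₁∼v (does-false (Twins? r₁ v) Pv)) , id ]′ (cover v)

      from-injective₁ : ∀ {i j} → from (inj₁ i) ≡ from (inj₁ j) → i ≡ j
      from-injective₁ = inj₁-injective ∘ from-injective split

      from-injective₂ : ∀ {i j} → from (inj₂ i) ≡ from (inj₂ j) → i ≡ j
      from-injective₂ = inj₂-injective ∘ from-injective split

      r₁r₂-adjacent : adj G r₁ r₂ ≡ true
      r₁r₂-adjacent with adj G r₁ r₂ in eq
      ... | true  = refl
      ... | false with common-neighbour (Twins-≢ ¬r₁∼r₂) eq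
      ...   | o , r₁o , or₂ with cover o
      ...     | inj₁ r₁∼o = contradiction (trans (≡.sym or₂) (trans (≡.sym (Twins-adj r₁∼o Twins-refl ¬r₁∼r₂)) eq))
                                          λ ()
      ...     | inj₂ r₂∼o = contradiction (trans (≡.sym r₁o) (trans (≡.sym (Twins-adj Twins-refl r₂∼o ¬r₁∼r₂)) eq))
                                          λ ()

      cross : ∀ {u v} → Twins G r₁ u → Twins G r₂ v → adj G u v ≡ true
      cross r₁∼u r₂∼v = trans (≡.sym (Twins-adj r₁∼u r₂∼v ¬r₁∼r₂)) r₁r₂-adjacent

      G≅X+Y : G ≅ (induced G (from ∘ inj₁) +ᴳ induced G (from ∘ inj₂))
      G≅X+Y = ≅-partition true π λ u v Pu Pv → cross (class₁ Pu) (class₂ Pv)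

      X-uniform : ∀ {α} → Uniform r₁ α → ∀ i j → i ≢ j → adj (induced G (from ∘ inj₁)) i j ≡ α
      X-uniform = induced-uniform from-injective₁ (class₁ ∘ inside)

      Y-uniform : ∀ {α} → Uniform r₂ α → ∀ i j → i ≢ j → adj (induced G (from ∘ inj₂)) i j ≡ α
      Y-uniform = induced-uniform from-injective₂ (class₂ ∘ outside)

    both-cliques : Uniform r₁ true → Uniform r₂ true → ⊥
    both-cliques u₁ u₂ = ¬r₁∼r₂ λ z z≢r₁ z≢r₂ →
      [ (λ r₁∼z → trans (u₁ Twins-refl r₁∼z (≢-sym z≢r₁)) (≡.sym (trans (sym G r₂ z) (cross r₁∼z Twins-refl))))
      , (λ r₂∼z → trans (cross Twins-refl r₂∼z) (≡.sym (u₂ Twins-refl r₂∼z (≢-sym z≢r₂))))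
      ]′ (cover z)

    clique+independent : Uniform r₁ true → Uniform r₂ false → Shape G
    clique+independent u₁ u₂ with separator ¬r₁∼r₂
    ... | z , z≢r₁ , z≢r₂ , r₁z≢r₂z =
      ≅K+E (count P) (count (not ∘ P)) (2≤outside Pz Pr₂ z≢r₂)
           (≅-trans G≅X+Y (sumGraph-cong (≅-K (X-uniform u₁)) (≅-E (Y-uniform u₂))))
      where
      -- a vertex separating r₁ from r₂ lies in the independent class
      Pz : P z ≡ false
      Pz = dec-false (Twins? r₁ z) λ r₁∼z →
        r₁z≢r₂z (trans (u₁ Twins-refl r₁∼z (≢-sym z≢r₁)) (≡.sym (trans (sym G r₂ z) (cross r₁∼z Twins-refl))))
      Pr₂ : P r₂ ≡ false
      Pr₂ = dec-false (Twins? r₁ r₂) ¬r₁∼r₂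

    both-independent : Uniform r₁ false → Uniform r₂ false → Shape G
    both-independent u₁ u₂ = by-size (count (not ∘ P) ℕ.≤? count P)
      where
      G≅Ea+Eb : G ≅ Kbip (count P) (count (not ∘ P))
      G≅Ea+Eb = ≅-trans G≅X+Y (sumGraph-cong (≅-E (X-uniform u₁)) (≅-E (Y-uniform u₂)))
      by-size : Dec (count (not ∘ P) ≤ count P) → Shape G
      by-size (yes b≤a) = ≅Kbip _ _ b≤a G≅Ea+Eb
      by-size (no b≰a)  = ≅Kbip _ _ (ℕ.<⇒≤ (ℕ.≰⇒> b≰a)) (≅-trans G≅Ea+Eb (sumGraph-comm {G = E (count P)}))

  two-classes : ∀ {r₁ r₂} → ¬ Twins G r₁ r₂ → (∀ v → Twins G r₁ v ⊎ Twins G r₂ v) → Shape G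
  two-classes {r₁} {r₂} ¬r₁∼r₂ cover with twin-class-uniform r₁ | twin-class-uniform r₂
  ... | true  , u₁ | true  , u₂ = ⊥-elim (TwoClasses.both-cliques ¬r₁∼r₂ cover u₁ u₂)
  ... | true  , u₁ | false , u₂ = TwoClasses.clique+independent ¬r₁∼r₂ cover u₁ u₂
  ... | false , u₁ | true  , u₂ = TwoClasses.clique+independent (¬r₁∼r₂ ∘ Twins-sym) (Sum.swap ∘ cover) u₂ u₁
  ... | false , u₁ | false , u₂ = TwoClasses.both-independent ¬r₁∼r₂ cover u₁ u₂

  module ThreeClasses {a b c} (¬a∼b : ¬ Twins G a b) (¬a∼c : ¬ Twins G a c) (¬b∼c : ¬ Twins G b c)
                      (cover : ∀ v → Twins G a v ⊎ Twins G b v ⊎ Twins G c v)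
                      (ab∼c : TwinsOutside a b c) (ac : adj G a c ≡ true) (bc : adj G b c ≡ false) where

    private
      c-alone : ∀ {v} → Twins G c v → v ≡ c
      c-alone {v} c∼v with v ≟ c
      ... | yes v≡c = v≡c
      ... | no v≢c  = contradiction (ab∼c v v≢a v≢b v≢c) (T≢F av bv)
        where
        v≢a : v ≢ a
        v≢a refl = ¬a∼c (Twins-sym c∼v)
        v≢b : v ≢ b
        v≢b refl = ¬b∼c (Twins-sym c∼v)
        av : adj G a v ≡ true
        av = trans (≡.sym (Twins-adj Twins-refl c∼v ¬a∼c)) ac
        bv : adj G b v ≡ false
        bv = trans (≡.sym (Twins-adj Twins-refl c∼v ¬b∼c)) bc

      ab : adj G a b ≡ true
      ab with common-neighbour (Twins-≢ ¬b∼c) bc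
      ... | o , bo , oc with cover o
      ...   | inj₁ a∼o        = trans (sym G a b) (trans (Twins-adj Twins-refl a∼o (¬a∼b ∘ Twins-sym)) bo)
      ...   | inj₂ (inj₁ b∼o) = contradiction (trans (≡.sym bc) (trans (Twins-adj b∼o Twins-refl ¬b∼c) oc)) λ ()
      ...   | inj₂ (inj₂ c∼o) =
        contradiction (trans (≡.sym oc) (trans (cong (λ w → adj G w c) (c-alone c∼o)) (irrefl G c))) λ ()

      cross-AB : ∀ {u v} → Twins G a u → Twins G b v → adj G u v ≡ true
      cross-AB a∼u b∼v = trans (≡.sym (Twins-adj a∼u b∼v ¬a∼b)) ab

      cross-AC : ∀ {u} → Twins G a u → adj G u c ≡ true
      cross-AC a∼u = trans (≡.sym (Twins-adj a∼u Twins-refl ¬a∼c)) ac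

      cross-BC : ∀ {v} → Twins G b v → adj G v c ≡ false
      cross-BC b∼v = trans (≡.sym (Twins-adj b∼v Twins-refl ¬b∼c)) bc

      A-clique : Uniform a true
      A-clique = clique-class λ {w} a∼w w≢a →
        trans (ab∼c w w≢a (λ { refl → ¬a∼b a∼w }) (λ { refl → ¬a∼c a∼w }))
              (trans (sym G b w) (cross-AB a∼w Twins-refl))

      B-clique : Uniform b true
      B-clique = clique-class λ {w} b∼w w≢b →
        trans (≡.sym (ab∼c w (λ { refl → ¬a∼b (Twins-sym b∼w) }) w≢b (λ { refl → ¬b∼c b∼w })))
              (cross-AB Twins-refl b∼w)

      A : Fin n → Bool
      A v = does (Twins? a v)
      π = partition A
      open Partition π using (split; from; inside; outside; index₂; 3≤outside)

      ¬A⇒B∪C : ∀ {v} → A v ≡ false → Twins G b v ⊎ v ≡ c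
      ¬A⇒B∪C {v} Av = [ (λ a∼v → contradiction a∼v (does-false (Twins? a v) Av)) , Sum.map₂ c-alone ]′ (cover v)

      -- the vertex separating b from c is a second member of b's class
      second-in-B : Σ (Fin n) λ z → z ≢ b × z ≢ c × Twins G b z
      second-in-B with separator ¬b∼c
      ... | z , z≢b , z≢c , bz≢cz with cover z
      ...   | inj₁ a∼z        = contradiction (trans (trans (sym G b z) (cross-AB a∼z Twins-refl))
                                                     (≡.sym (trans (sym G c z) (cross-AC a∼z)))) bz≢cz
      ...   | inj₂ (inj₁ b∼z) = z , z≢b , z≢c , b∼z
      ...   | inj₂ (inj₂ c∼z) = contradiction (c-alone c∼z) z≢c

      B⇒¬A : ∀ {v} → Twins G b v → A v ≡ false
      B⇒¬A b∼v = dec-false (Twins? a _) λ a∼v → ¬a∼b (Twins-trans a∼v (Twins-sym b∼v))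

      Ac : A c ≡ false
      Ac = dec-false (Twins? a c) ¬a∼c

      c′ = proj₁ (index₂ Ac)
      from-c′ : from (inj₂ c′) ≡ c
      from-c′ = proj₂ (index₂ Ac)

      G[A]≅K : induced G (from ∘ inj₁) ≅ K (count A)
      G[A]≅K = ≅-K (induced-uniform (inj₁-injective ∘ from-injective split) (does-true (Twins? a _) ∘ inside) A-clique)

      G[¬A]≅K∪K₁ : induced G (from ∘ inj₂) ≅ (K (count (not ∘ A) ∸ 1) ∪ᴳ K 1)
      G[¬A]≅K∪K₁ = ≅-K∪K₁ c′ isolated clique
        where
        isolated : ∀ j → adj G (from (inj₂ c′)) (from (inj₂ j)) ≡ false
        isolated j rewrite from-c′ with ¬A⇒B∪C (outside j)
        ... | inj₁ b∼v = trans (sym G c _) (cross-BC b∼v)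
        ... | inj₂ v≡c = trans (cong (adj G c) v≡c) (irrefl G c)
        ≢c : ∀ {j} → j ≢ c′ → from (inj₂ j) ≢ c
        ≢c j≢c′ v≡c = j≢c′ (inj₂-injective (from-injective split (trans v≡c (≡.sym from-c′))))
        in-B : ∀ {j} → j ≢ c′ → Twins G b (from (inj₂ j))
        in-B {j} j≢c′ = [ id , (λ v≡c → contradiction v≡c (≢c j≢c′)) ]′ (¬A⇒B∪C (outside j))
        clique : ∀ i j → i ≢ c′ → j ≢ c′ → i ≢ j → adj G (from (inj₂ i)) (from (inj₂ j)) ≡ true
        clique i j i≢c′ j≢c′ i≢j = B-clique (in-B i≢c′) (in-B j≢c′) (i≢j ∘ inj₂-injective ∘ from-injective split)

    shape : Shape G
    shape with second-in-B
    ... | z , z≢b , z≢c , b∼z =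
      ≅K+K∪K₁ (count A) (count (not ∘ A) ∸ 1)
              (ℕ.∸-monoˡ-≤ 1 (3≤outside Ac (B⇒¬A Twins-refl) (B⇒¬A b∼z)
                                         (≢-sym (Twins-≢ ¬b∼c)) (≢-sym z≢c) (≢-sym z≢b)))
              (≅-trans (≅-partition true π cross) (sumGraph-cong G[A]≅K G[¬A]≅K∪K₁))
      where
      cross : ∀ u v → A u ≡ true → A v ≡ false → adj G u v ≡ true
      cross u v Au Av = [ cross-AB a∼u , (λ { refl → cross-AC a∼u }) ]′ (¬A⇒B∪C Av)
        where a∼u = does-true (Twins? a u) Au

  private
    oriented : ∀ {a b c} → ¬ Twins G a b → ¬ Twins G a c → ¬ Twins G b c →
               (∀ v → Twins G a v ⊎ Twins G b v ⊎ Twins G c v) → TwinsOutside a b c → Shape G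
    oriented {a} {b} {c} ¬a∼b ¬a∼c ¬b∼c cover ab∼c = by-adjacency (adj G a c) refl
      where
      only = only-separator ab∼c ¬a∼b
      bc≡not-ac : adj G b c ≡ not (adj G a c)
      bc≡not-ac = ¬-not (≢-sym (proj₂ only))
      by-adjacency : ∀ α → adj G a c ≡ α → Shape G
      by-adjacency true  ac = ThreeClasses.shape ¬a∼b ¬a∼c ¬b∼c cover ab∼c ac (trans bc≡not-ac (cong not ac))
      by-adjacency false ac =
        ThreeClasses.shape (¬a∼b ∘ Twins-sym) ¬b∼c ¬a∼c ([ inj₂ ∘ inj₁ , [ inj₁ , inj₂ ∘ inj₂ ]′ ]′ ∘ cover)
                                (proj₁ (OnlySeparator-sym only)) (trans bc≡not-ac (cong not ac)) ac

  three-classes : ∀ {a b c} → ¬ Twins G a b → ¬ Twins G a c → ¬ Twins G b c →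
                  (∀ v → Twins G a v ⊎ Twins G b v ⊎ Twins G c v) → Shape G
  three-classes ¬a∼b ¬a∼c ¬b∼c cover with twins-outside-third (Twins-≢ ¬a∼b) (Twins-≢ ¬a∼c) (Twins-≢ ¬b∼c)
  ... | inj₁ ab∼c        = oriented ¬a∼b ¬a∼c ¬b∼c cover ab∼c
  ... | inj₂ (inj₁ ac∼b) =
    oriented ¬a∼c ¬a∼b (¬b∼c ∘ Twins-sym) ([ inj₁ , [ inj₂ ∘ inj₂ , inj₂ ∘ inj₁ ]′ ]′ ∘ cover) ac∼b
  ... | inj₂ (inj₂ bc∼a) =
    oriented ¬b∼c (¬a∼b ∘ Twins-sym) (¬a∼c ∘ Twins-sym) ([ inj₂ ∘ inj₂ , [ inj₁ , inj₂ ∘ inj₁ ]′ ]′ ∘ cover) bc∼a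

  classification : Shape G
  classification with non-twins
  ... | r₁ , r₂ , ¬r₁∼r₂ with all? (λ v → Twins? r₁ v ⊎-dec Twins? r₂ v)
  ...   | yes cover₂ = two-classes ¬r₁∼r₂ cover₂
  ...   | no ¬cover₂ with ¬∀⟶∃¬ n _ (λ v → Twins? r₁ v ⊎-dec Twins? r₂ v) ¬cover₂
  ...     | r₃ , ¬r₃ with all? (λ v → Twins? r₁ v ⊎-dec Twins? r₂ v ⊎-dec Twins? r₃ v)
  ...       | yes cover₃ = three-classes ¬r₁∼r₂ (¬r₃ ∘ inj₁) (¬r₃ ∘ inj₂) cover₃
  ...       | no ¬cover₃ with ¬∀⟶∃¬ n _ (λ v → Twins? r₁ v ⊎-dec Twins? r₂ v ⊎-dec Twins? r₃ v) ¬cover₃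
  ...         | r₄ , ¬r₄ =
    ⊥-elim (four-non-twins ¬r₁∼r₂ (¬r₃ ∘ inj₁) (¬r₄ ∘ inj₁) (¬r₃ ∘ inj₂) (¬r₄ ∘ inj₂ ∘ inj₁)
                           (¬r₄ ∘ inj₂ ∘ inj₂))

-- Distinguishing numbers

Distinguishing-≅ : ∀ {n m k} {G : Graph n} {H : Graph m} (φ : G ≅ H) {c : Fin n → Fin k} →
                   Distinguishing G c → Distinguishing H (c ∘ Inverse.from (bij φ))
Distinguishing-≅ {G = G} {H} φ {c} c-dist σ σ-preserves v = from-injective (bij φ) (begin
  from (to′ σ v)              ≡⟨ cong (from ∘ to′ σ) (strictlyInverseˡ v) ⟨
  from (to′ σ (to (from v)))  ≡⟨ c-dist τ τ-preserves (from v) ⟩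
  from v                      ∎)
  where
  open Inverse (bij φ)
  open ≡.≡-Reasoning
  to′ : Aut H → Fin _ → Fin _
  to′ σ = Inverse.to (bij σ)
  τ : Aut G
  τ = ≅-trans φ (≅-trans σ (≅-sym φ))
  τ-preserves : ∀ u → c (Inverse.to (bij τ) u) ≡ c u
  τ-preserves u = trans (σ-preserves (to u)) (cong c (strictlyInverseʳ u))

≅-IsDistNum : ∀ {n m d} {G : Graph n} {H : Graph m} → G ≅ H → IsDistNum G d → IsDistNum H d
≅-IsDistNum φ ((c , c-dist) , minimal) =
  (_ , Distinguishing-≅ φ c-dist) , λ k c′ c′-dist → minimal k _ (Distinguishing-≅ (≅-sym φ) c′-dist)

IsDistNum⇒≡ : ∀ {n d k} {G : Graph n} → IsDistNum G d → (∀ k′ (c : Fin n → Fin k′) → Distinguishing G c → k ≤ k′) →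
              Σ (Fin n → Fin k) (Distinguishing G) → d ≡ k
IsDistNum⇒≡ ((c , c-dist) , minimal) lower (c′ , c′-dist) = ℕ.≤-antisym (minimal _ c′ c′-dist) (lower _ c c-dist)

data TranspositionView {n} (i j k : Fin n) : Fin n → Set where
  at-i  : k ≡ i → TranspositionView i j k j
  at-j  : k ≢ i → k ≡ j → TranspositionView i j k i
  other : k ≢ i → k ≢ j → TranspositionView i j k k

transposition-view : ∀ {n} (i j k : Fin n) → TranspositionView i j k (PC.transpose i j k)
transposition-view i j k with k ≟ i
... | yes k≡i = at-i k≡i
... | no k≢i with k ≟ j
...   | yes k≡j = at-j k≢i k≡j
...   | no k≢j  = other k≢i k≢j

module _ {n} {G : Graph n} {i j : Fin n} (i∼j : Twins G i j) where

  twin-transposition : Aut G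
  twin-transposition =
    record { bij = transpose i j ; pres = λ u v → pres′ (transposition-view i j u) (transposition-view i j v) }
    where
    pres′ : ∀ {u v u′ v′} → TranspositionView i j u u′ → TranspositionView i j v v′ → adj G u′ v′ ≡ adj G u v
    pres′ (at-i refl)      (at-i refl)      = trans (irrefl G j) (≡.sym (irrefl G i))
    pres′ (at-i refl)      (at-j _ refl)    = sym G j i
    pres′ (at-i refl)      (other v≢i v≢j)  = ≡.sym (i∼j _ v≢i v≢j)
    pres′ (at-j _ refl)    (at-i refl)      = sym G i j
    pres′ (at-j _ refl)    (at-j _ refl)    = trans (irrefl G i) (≡.sym (irrefl G j))
    pres′ (at-j _ refl)    (other v≢i v≢j)  = i∼j _ v≢i v≢j
    pres′ (other u≢i u≢j)  (at-i refl)      = trans (sym G _ j) (trans (≡.sym (i∼j _ u≢i u≢j)) (sym G i _))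
    pres′ (other u≢i u≢j)  (at-j _ refl)    = trans (sym G _ i) (trans (i∼j _ u≢i u≢j) (sym G j _))
    pres′ (other _ _)      (other _ _)      = refl

  Distinguishing⇒twins-apart : ∀ {k} {c : Fin n → Fin k} → Distinguishing G c → c i ≡ c j → i ≡ j
  Distinguishing⇒twins-apart {c = c} c-dist ci≡cj =
    moved (transposition-view i j i) (c-dist twin-transposition (λ v → recoloured (transposition-view i j v)) i)
    where
    recoloured : ∀ {v v′} → TranspositionView i j v v′ → c v′ ≡ c v
    recoloured (at-i refl)   = ≡.sym ci≡cj
    recoloured (at-j _ refl) = ci≡cj
    recoloured (other _ _)   = refl
    moved : ∀ {i′} → TranspositionView i j i i′ → i′ ≡ i → i ≡ j
    moved (at-i _)      j≡i = ≡.sym j≡i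
    moved (at-j i≢i _)  _   = contradiction refl i≢i
    moved (other i≢i _) _   = contradiction refl i≢i

twin-family-coloured-apart : ∀ {n k k′} {G : Graph n} (f : Fin k → Fin n) → (∀ {a b} → f a ≡ f b → a ≡ b) →
  (∀ a b → Twins G (f a) (f b)) → (c : Fin n → Fin k′) → Distinguishing G c → ∀ {a b} → c (f a) ≡ c (f b) → a ≡ b
twin-family-coloured-apart f f-injective twins c c-dist {a} {b} ca≡cb =
  f-injective (Distinguishing⇒twins-apart (twins a b) c-dist ca≡cb)

twin-family≤colours : ∀ {n k k′} {G : Graph n} (f : Fin k → Fin n) → (∀ {a b} → f a ≡ f b → a ≡ b) →
                      (∀ a b → Twins G (f a) (f b)) → (c : Fin n → Fin k′) → Distinguishing G c → k ≤ k′
twin-family≤colours f f-injective twins c c-dist = injective⇒≤ (twin-family-coloured-apart f f-injective twins c c-dist)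

distinguishing-by-invariant : ∀ {n k} {X : Set} {G : Graph n} (c : Fin n → Fin k) (key : Fin n → X) →
  (∀ u v → key u ≡ key v → c u ≡ c v → u ≡ v) →
  (∀ (σ : Aut G) → (∀ v → c (Inverse.to (bij σ) v) ≡ c v) → ∀ v → key (Inverse.to (bij σ) v) ≡ key v) →
  Distinguishing G c
distinguishing-by-invariant c key determined invariant σ preserves v = determined _ _ (invariant σ preserves v) (preserves v)

module Invariants {n} (G : Graph n) where

  Dominating : Fin n → Set
  Dominating x = ∀ y → y ≢ x → adj G x y ≡ true

  TwoNonNeighbours : Fin n → Set
  TwoNonNeighbours x = Σ (Fin n) λ y₁ → Σ (Fin n) λ y₂ →
    y₁ ≢ y₂ × y₁ ≢ x × y₂ ≢ x × adj G x y₁ ≡ false × adj G x y₂ ≡ false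

  Invariant : (Fin n → Set) → Set
  Invariant Q = ∀ (σ : Aut G) {x} → Q x → Q (Inverse.to (bij σ) x)

  Dominating-invariant : Invariant Dominating
  Dominating-invariant σ {x} dom y y≢σx = begin
    adj G (to x) y         ≡⟨ cong (adj G (to x)) (strictlyInverseˡ y) ⟨
    adj G (to x) (to (from y)) ≡⟨ pres σ x (from y) ⟩
    adj G x (from y)       ≡⟨ dom (from y) (λ { refl → y≢σx (≡.sym (strictlyInverseˡ y)) }) ⟩
    true                   ∎
    where
    open Inverse (bij σ)
    open ≡.≡-Reasoning

  TwoNonNeighbours-invariant : Invariant TwoNonNeighbours
  TwoNonNeighbours-invariant σ (y₁ , y₂ , y₁≢y₂ , y₁≢x , y₂≢x , xy₁ , xy₂) =
    to y₁ , to y₂ , y₁≢y₂ ∘ to-injective (bij σ) , y₁≢x ∘ to-injective (bij σ) , y₂≢x ∘ to-injective (bij σ) ,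
    trans (pres σ _ y₁) xy₁ , trans (pres σ _ y₂) xy₂
    where open Inverse (bij σ)

  ¬-invariant : ∀ {Q} → Invariant Q → Invariant (¬_ ∘ Q)
  ¬-invariant {Q} inv σ {x} ¬Qx Qσx = ¬Qx (≡.subst Q (strictlyInverseʳ x) (inv (≅-sym σ) Qσx))
    where open Inverse (bij σ)

  key-invariant : ∀ {Q} → Invariant Q → (key : Fin n → Bool) → (∀ v → key v ≡ true → Q v) →
                  (∀ v → key v ≡ false → ¬ Q v) → ∀ (σ : Aut G) v → key (Inverse.to (bij σ) v) ≡ key v
  key-invariant inv key true⇒Q false⇒¬Q σ v with key v in kv | key (Inverse.to (bij σ) v) in kσv
  ... | true  | true  = refl
  ... | false | false = refl
  ... | true  | false = contradiction (inv σ (true⇒Q v kv)) (false⇒¬Q _ kσv)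
  ... | false | true  = contradiction (¬-invariant inv σ (false⇒¬Q v kv)) λ ¬Qσv → ¬Qσv (true⇒Q _ kσv)

Twins-K : ∀ {k} (i j : Fin k) → Twins (K k) i j
Twins-K i j z z≢i z≢j = cong not (trans (dec-false (i ≟ z) (≢-sym z≢i)) (≡.sym (dec-false (j ≟ z) (≢-sym z≢j))))

Twins-E : ∀ {k} (i j : Fin k) → Twins (E k) i j
Twins-E _ _ _ _ _ = refl

module SumGraph {a b} (c : Bool) (H₁ : Graph a) (H₂ : Graph b) where

  H : Graph (a + b)
  H = sumGraph c H₁ H₂

  data View : Fin (a + b) → Set where
    left  : ∀ i → View (i ↑ˡ b)
    right : ∀ j → View (a ↑ʳ j)

  view : ∀ v → View v
  view v with splitAt a v in eq
  ... | inj₁ i = ≡.subst View (splitAt⁻¹-↑ˡ eq) (left i)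
  ... | inj₂ j = ≡.subst View (splitAt⁻¹-↑ʳ eq) (right j)

  ↑ˡ-injective′ : ∀ {i i′ : Fin a} → i ↑ˡ b ≡ i′ ↑ˡ b → i ≡ i′
  ↑ˡ-injective′ = ↑ˡ-injective b _ _

  ↑ʳ-injective′ : ∀ {j j′ : Fin b} → a ↑ʳ j ≡ a ↑ʳ j′ → j ≡ j′
  ↑ʳ-injective′ = ↑ʳ-injective a _ _

  adj-left : ∀ i i′ → adj H (i ↑ˡ b) (i′ ↑ˡ b) ≡ adj H₁ i i′
  adj-left i i′ rewrite splitAt-↑ˡ a i b | splitAt-↑ˡ a i′ b = refl

  adj-right : ∀ j j′ → adj H (a ↑ʳ j) (a ↑ʳ j′) ≡ adj H₂ j j′
  adj-right j j′ rewrite splitAt-↑ʳ a b j | splitAt-↑ʳ a b j′ = refl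

  adj-cross : ∀ i j → adj H (i ↑ˡ b) (a ↑ʳ j) ≡ c
  adj-cross i j rewrite splitAt-↑ˡ a i b | splitAt-↑ʳ a b j = refl

  adj-cross′ : ∀ i j → adj H (a ↑ʳ j) (i ↑ˡ b) ≡ c
  adj-cross′ i j = trans (sym H (a ↑ʳ j) (i ↑ˡ b)) (adj-cross i j)

  Twins-left : ∀ {i i′} → Twins H₁ i i′ → Twins H (i ↑ˡ b) (i′ ↑ˡ b)
  Twins-left {i} {i′} i∼i′ z z≢i z≢i′ with view z
  ... | left k  =
    trans (adj-left i k) (trans (i∼i′ k (z≢i ∘ cong (_↑ˡ b)) (z≢i′ ∘ cong (_↑ˡ b))) (≡.sym (adj-left i′ k)))
  ... | right j = trans (adj-cross i j) (≡.sym (adj-cross i′ j))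

  Twins-right : ∀ {j j′} → Twins H₂ j j′ → Twins H (a ↑ʳ j) (a ↑ʳ j′)
  Twins-right {j} {j′} j∼j′ z z≢j z≢j′ with view z
  ... | left i  = trans (adj-cross′ i j) (≡.sym (adj-cross′ i j′))
  ... | right k =
    trans (adj-right j k) (trans (j∼j′ k (z≢j ∘ cong (a ↑ʳ_)) (z≢j′ ∘ cong (a ↑ʳ_))) (≡.sym (adj-right j′ k)))

  left≢right : ∀ {i j} → i ↑ˡ b ≢ a ↑ʳ j
  left≢right {i} {j} eq with trans (≡.sym (splitAt-↑ˡ a i b)) (trans (cong (splitAt a) eq) (splitAt-↑ʳ a b j))
  ... | ()

  side : Fin (a + b) → Bool
  side v = [ (λ _ → true) , (λ _ → false) ]′ (splitAt a v)

  side-left : ∀ i → side (i ↑ˡ b) ≡ true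
  side-left i rewrite splitAt-↑ˡ a i b = refl

  side-right : ∀ j → side (a ↑ʳ j) ≡ false
  side-right j rewrite splitAt-↑ʳ a b j = refl

  module Colouring {k} (f : Fin a → Fin k) (g : Fin b → Fin k) where

    colour : Fin (a + b) → Fin k
    colour v = [ f , g ]′ (splitAt a v)

    colour-left : ∀ i → colour (i ↑ˡ b) ≡ f i
    colour-left i rewrite splitAt-↑ˡ a i b = refl

    colour-right : ∀ j → colour (a ↑ʳ j) ≡ g j
    colour-right j rewrite splitAt-↑ʳ a b j = refl

-- A colour-preserving automorphism fixes the only vertex w of colour f i₀, and adjacency
-- to w tells the two sides apart.
Kbip-distinguishing : ∀ {a b k} {f : Fin a → Fin k} {g : Fin b → Fin k} → (∀ {i i′} → f i ≡ f i′ → i ≡ i′) →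
  (∀ {j j′} → g j ≡ g j′ → j ≡ j′) → (i₀ : Fin a) → (∀ j → g j ≢ f i₀) →
  Distinguishing (Kbip a b) (SumGraph.Colouring.colour true (E a) (E b) f g)
Kbip-distinguishing {a} {b} {f = f} {g} f-injective g-injective i₀ unused =
  distinguishing-by-invariant colour (λ v → adj H v w) (λ u v → determined (view u) (view v)) invariant
  where
  open SumGraph true (E a) (E b)
  open Colouring f g
  w = i₀ ↑ˡ b
  w-coloured-once : ∀ {v} → View v → colour v ≡ colour w → v ≡ w
  w-coloured-once (left i)  eq = cong (_↑ˡ b) (f-injective (trans (≡.sym (colour-left i)) (trans eq (colour-left i₀))))
  w-coloured-once (right j) eq = contradiction (trans (≡.sym (colour-right j)) (trans eq (colour-left i₀))) (unused j)
  invariant : ∀ (σ : Aut (Kbip a b)) → (∀ v → colour (Inverse.to (bij σ) v) ≡ colour v) →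
              ∀ v → adj H (Inverse.to (bij σ) v) w ≡ adj H v w
  invariant σ preserves v = trans (cong (adj H _) (≡.sym σw≡w)) (pres σ v w)
    where σw≡w = w-coloured-once (view (Inverse.to (bij σ) w)) (preserves w)
  determined : ∀ {u v} → View u → View v → adj H u w ≡ adj H v w → colour u ≡ colour v → u ≡ v
  determined (left i)  (left i′)  _ eq = cong (_↑ˡ b) (f-injective (trans (≡.sym (colour-left i)) (trans eq (colour-left i′))))
  determined (right j) (right j′) _ eq =
    cong (a ↑ʳ_) (g-injective (trans (≡.sym (colour-right j)) (trans eq (colour-right j′))))
  determined (left i)  (right j)  uw≡vw _ = contradiction (trans (≡.sym (adj-left i i₀)) (trans uw≡vw (adj-cross′ i₀ j))) λ ()
  determined (right j) (left i)   uw≡vw _ = contradiction (trans (≡.sym (adj-cross′ i₀ j)) (trans uw≡vw (adj-left i i₀))) λ ()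

D-Kbip-unbalanced : ∀ a b {d} → b < a → IsDistNum (Kbip a b) d → d ≡ a
D-Kbip-unbalanced (suc a) b (s≤s b≤a) D = IsDistNum⇒≡ D lower
  (_ , Kbip-distinguishing id (inject≤-injective _ _ _ _) (fromℕ a) unused)
  where
  open SumGraph true (E (suc a)) (E b)
  lower : ∀ k (c : Fin (suc a + b) → Fin k) → Distinguishing (Kbip (suc a) b) c → suc a ≤ k
  lower _ = twin-family≤colours (_↑ˡ b) ↑ˡ-injective′ λ i i′ → Twins-left (Twins-E i i′)
  unused : ∀ j → inject≤ j (ℕ.m≤n⇒m≤1+n b≤a) ≢ fromℕ a
  unused j eq = ℕ.<⇒≢ (ℕ.<-≤-trans (toℕ<n j) b≤a)
                  (trans (≡.sym (toℕ-inject≤ j _)) (trans (cong toℕ eq) (toℕ-fromℕ a)))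

-- With fewer than a + 1 colours both sides carry all colours, and matching equal colours across
-- the sides is a colour-preserving automorphism moving every vertex.
Kbip-balanced-lower-bound : ∀ {a k} (c : Fin (a + a) → Fin k) → Distinguishing (Kbip a a) c → Fin a → suc a ≤ k
Kbip-balanced-lower-bound {a} {k} c c-distinguishing i₀ with suc a ℕ.≤? k
... | yes a<k = a<k
... | no a≮k  = contradiction (c-distinguishing σ preserves (i₀ ↑ˡ a)) moved
  where
  open SumGraph true (E a) (E a)
  k≤a = ℕ.≤-pred (ℕ.≰⇒> a≮k)
  cˡ cʳ : Fin a → Fin k
  cˡ i = c (i ↑ˡ a)
  cʳ j = c (a ↑ʳ j)
  cˡ-injective : ∀ {i i′} → cˡ i ≡ cˡ i′ → i ≡ i′
  cˡ-injective = twin-family-coloured-apart (_↑ˡ a) ↑ˡ-injective′ (λ i i′ → Twins-left (Twins-E i i′)) c c-distinguishing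
  cʳ-injective : ∀ {j j′} → cʳ j ≡ cʳ j′ → j ≡ j′
  cʳ-injective = twin-family-coloured-apart (a ↑ʳ_) ↑ʳ-injective′ (λ j j′ → Twins-right (Twins-E j j′)) c c-distinguishing
  cˡ⁻¹ cʳ⁻¹ : Fin k → Fin a
  cˡ⁻¹ y = proj₁ (injective⇒surjective cˡ-injective k≤a y)
  cʳ⁻¹ y = proj₁ (injective⇒surjective cʳ-injective k≤a y)
  cˡ∘cˡ⁻¹ : ∀ y → cˡ (cˡ⁻¹ y) ≡ y
  cˡ∘cˡ⁻¹ y = proj₂ (injective⇒surjective cˡ-injective k≤a y)
  cʳ∘cʳ⁻¹ : ∀ y → cʳ (cʳ⁻¹ y) ≡ y
  cʳ∘cʳ⁻¹ y = proj₂ (injective⇒surjective cʳ-injective k≤a y)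
  swap : Fin a ⊎ Fin a → Fin a ⊎ Fin a
  swap (inj₁ i) = inj₂ (cʳ⁻¹ (cˡ i))
  swap (inj₂ j) = inj₁ (cˡ⁻¹ (cʳ j))
  swap-involutive : ∀ x → swap (swap x) ≡ x
  swap-involutive (inj₁ i) = cong inj₁ (cˡ-injective (trans (cˡ∘cˡ⁻¹ _) (cʳ∘cʳ⁻¹ _)))
  swap-involutive (inj₂ j) = cong inj₂ (cʳ-injective (trans (cʳ∘cʳ⁻¹ _) (cˡ∘cˡ⁻¹ _)))
  swap-pres : ∀ x y → sumAdj true (E a) (E a) (swap x) (swap y) ≡ sumAdj true (E a) (E a) x y
  swap-pres (inj₁ _) (inj₁ _) = refl
  swap-pres (inj₁ _) (inj₂ _) = refl
  swap-pres (inj₂ _) (inj₁ _) = refl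
  swap-pres (inj₂ _) (inj₂ _) = refl
  σ : Aut (Kbip a a)
  σ = ≅-sumGraph (↔-trans +↔⊎ (mk↔ₛ′ swap swap swap-involutive swap-involutive))
                 λ u v → swap-pres (splitAt a u) (splitAt a v)
  preserves : ∀ v → c (Inverse.to (bij σ) v) ≡ c v
  preserves v = recoloured (view v)
    where
    recoloured : ∀ {v} → View v → c (Inverse.to (bij σ) v) ≡ c v
    recoloured (left i)  rewrite splitAt-↑ˡ a i a = cʳ∘cʳ⁻¹ (cˡ i)
    recoloured (right j) rewrite splitAt-↑ʳ a a j = cˡ∘cˡ⁻¹ (cʳ j)
  moved : Inverse.to (bij σ) (i₀ ↑ˡ a) ≢ i₀ ↑ˡ a
  moved eq rewrite splitAt-↑ˡ a i₀ a = left≢right (≡.sym eq)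

D-Kbip-balanced : ∀ a {d} → 1 ≤ a → IsDistNum (Kbip a a) d → d ≡ suc a
D-Kbip-balanced (suc a) _ D = IsDistNum⇒≡ D (λ _ c c-dist → Kbip-balanced-lower-bound c c-dist zero)
  (_ , Kbip-distinguishing inject₁-injective suc-injective zero λ _ ())

D-K+E : ∀ a b {d} → 2 ≤ b → IsDistNum (K a +ᴳ E b) d → d ≡ a ⊔ b
D-K+E a b 2≤b D = IsDistNum⇒≡ D lower
  (colour , distinguishing-by-invariant colour side (λ u v → determined (view u) (view v))
              λ σ _ → key-invariant Dominating-invariant side (λ v → left⇒dominating (view v))
                                                              (λ v → right⇒¬dominating (view v)) σ)
  where
  open SumGraph true (K a) (E b)
  open Colouring (λ i → inject≤ i (ℕ.m≤m⊔n a b)) (λ j → inject≤ j (ℕ.m≤n⊔m a b))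
  open Invariants H
  lower : ∀ k (c : Fin (a + b) → Fin k) → Distinguishing H c → a ⊔ b ≤ k
  lower _ c c-dist = ℕ.⊔-lub (twin-family≤colours (_↑ˡ b) ↑ˡ-injective′ (λ i i′ → Twins-left (Twins-K i i′)) c c-dist)
                             (twin-family≤colours (a ↑ʳ_) ↑ʳ-injective′ (λ j j′ → Twins-right (Twins-E j j′)) c c-dist)
  determined : ∀ {u v} → View u → View v → side u ≡ side v → colour u ≡ colour v → u ≡ v
  determined (left i)  (left i′)  _ eq =
    cong (_↑ˡ b) (inject≤-injective _ _ i i′ (trans (≡.sym (colour-left i)) (trans eq (colour-left i′))))
  determined (right j) (right j′) _ eq =
    cong (a ↑ʳ_) (inject≤-injective _ _ j j′ (trans (≡.sym (colour-right j)) (trans eq (colour-right j′))))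
  determined (left i)  (right j)  eq _ = contradiction (trans (≡.sym (side-left i)) (trans eq (side-right j))) λ ()
  determined (right j) (left i)   eq _ = contradiction (trans (≡.sym (side-left i)) (trans (≡.sym eq) (side-right j))) λ ()
  left⇒dominating : ∀ {v} → View v → side v ≡ true → Dominating v
  left⇒dominating (left i) _ y y≢v with view y
  ... | left i′  = trans (adj-left i i′) (K-adj {i = i} {i′} λ { refl → y≢v refl })
  ... | right j  = adj-cross i j
  left⇒dominating (right j) sv = contradiction (trans (≡.sym sv) (side-right j)) λ ()
  right⇒¬dominating : ∀ {v} → View v → side v ≡ false → ¬ Dominating v
  right⇒¬dominating (left i) sv _ = contradiction (trans (≡.sym sv) (side-left i)) λ ()
  right⇒¬dominating (right j) _ dominating with another 2≤b j
  ... | j′ , j′≢j = contradiction (trans (≡.sym (dominating (a ↑ʳ j′) (j′≢j ∘ ↑ʳ-injective′))) (adj-right j j′)) λ ()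

module K+K∪K₁ (s t : ℕ) where

  module Outer = SumGraph true (K s) (K t ∪ᴳ K 1)
  module Inner = SumGraph false (K t) (K 1)
  open Outer using (H)
  open Invariants H

  c : Fin (s + (t + 1))
  c = s ↑ʳ (t ↑ʳ zero {0})

  data Part : Fin (s + (t + 1)) → Set where
    A : (i : Fin s) → Part (i ↑ˡ (t + 1))
    B : (j : Fin t) → Part (s ↑ʳ (j ↑ˡ 1))
    C : Part c

  part : ∀ v → Part v
  part v with Outer.view v
  ... | Outer.left i = A i
  ... | Outer.right w with Inner.view w
  ...   | Inner.left j     = B j
  ...   | Inner.right zero = C

  B≢C : ∀ {j} → s ↑ʳ (j ↑ˡ 1) ≢ c
  B≢C = Inner.left≢right ∘ Outer.↑ʳ-injective′

  adj-BB : ∀ j j′ → adj H (s ↑ʳ (j ↑ˡ 1)) (s ↑ʳ (j′ ↑ˡ 1)) ≡ adj (K t) j j′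
  adj-BB j j′ = trans (Outer.adj-right _ _) (Inner.adj-left j j′)

  adj-BC : ∀ j → adj H (s ↑ʳ (j ↑ˡ 1)) c ≡ false
  adj-BC j = trans (Outer.adj-right _ _) (Inner.adj-cross j zero)

  adj-CB : ∀ j → adj H c (s ↑ʳ (j ↑ˡ 1)) ≡ false
  adj-CB j = trans (sym H c _) (adj-BC j)

  A-dominating : ∀ i → Dominating (i ↑ˡ (t + 1))
  A-dominating i y y≢v with Outer.view y
  ... | Outer.left i′  = trans (Outer.adj-left i i′) (K-adj {i = i} {i′} λ { refl → y≢v refl })
  ... | Outer.right w  = Outer.adj-cross i w

  B-non-neighbour : ∀ j {y} → Part y → y ≢ s ↑ʳ (j ↑ˡ 1) → adj H (s ↑ʳ (j ↑ˡ 1)) y ≡ false → y ≡ c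
  B-non-neighbour j (A i)  _   jy = contradiction (trans (≡.sym jy) (Outer.adj-cross′ i _)) λ ()
  B-non-neighbour j (B j′) y≢v jy =
    contradiction (trans (≡.sym jy) (trans (adj-BB j j′) (K-adj {i = j} {j′} λ { refl → y≢v refl }))) λ ()
  B-non-neighbour j C      _   _  = refl

  module Colours {k} (f : Fin s → Fin k) (g : Fin t → Fin k) (j₀ : Fin t) where
    module I = Inner.Colouring g (λ _ → g j₀)
    module O = Outer.Colouring f I.colour

    colour : Fin (s + (t + 1)) → Fin k
    colour = O.colour

    colour-A : ∀ i → colour (i ↑ˡ (t + 1)) ≡ f i
    colour-A = O.colour-left

    colour-B : ∀ j → colour (s ↑ʳ (j ↑ˡ 1)) ≡ g j
    colour-B j = trans (O.colour-right _) (I.colour-left j)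

  -- Colour-preserving automorphisms fix the three parts: A consists of the dominating
  -- vertices, and c is the only vertex with two non-neighbours.
  distinguishing : ∀ {k} (f : Fin s → Fin k) (g : Fin t → Fin k) → (∀ {i i′} → f i ≡ f i′ → i ≡ i′) →
                   (∀ {j j′} → g j ≡ g j′ → j ≡ j′) → 2 ≤ t → Σ (Fin (s + (t + 1)) → Fin k) (Distinguishing H)
  distinguishing f g f-injective g-injective 2≤t =
    colour , distinguishing-by-invariant colour key (λ u v → determined (part u) (part v)) invariant
    where
    j₀ = proj₁ (distinct-pair 2≤t)
    j₁ = proj₁ (proj₂ (distinct-pair 2≤t))
    open Colours f g j₀
    is-c : Fin (s + (t + 1)) → Bool
    is-c v = does (v ≟ c)
    key : Fin (s + (t + 1)) → Bool × Bool
    key v = Outer.side v , is-c v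
    left⇒dominating : ∀ {v} → Part v → Outer.side v ≡ true → Dominating v
    left⇒dominating (A i) _  = A-dominating i
    left⇒dominating (B j) sv = contradiction (trans (≡.sym sv) (Outer.side-right _)) λ ()
    left⇒dominating C     sv = contradiction (trans (≡.sym sv) (Outer.side-right _)) λ ()
    right⇒¬dominating : ∀ {v} → Part v → Outer.side v ≡ false → ¬ Dominating v
    right⇒¬dominating (A i) sv _   = contradiction (trans (≡.sym sv) (Outer.side-left i)) λ ()
    right⇒¬dominating (B j) _  dom = contradiction (trans (≡.sym (dom c (≢-sym B≢C))) (adj-BC j)) λ ()
    right⇒¬dominating C     _  dom = contradiction (trans (≡.sym (dom (s ↑ʳ (j₀ ↑ˡ 1)) B≢C)) (adj-CB j₀)) λ ()
    is-c⇒two : ∀ v → is-c v ≡ true → TwoNonNeighbours v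
    is-c⇒two v v≡c rewrite does-true (v ≟ c) v≡c =
      s ↑ʳ (j₀ ↑ˡ 1) , s ↑ʳ (j₁ ↑ˡ 1) ,
      proj₂ (proj₂ (distinct-pair 2≤t)) ∘ Inner.↑ˡ-injective′ ∘ Outer.↑ʳ-injective′ ,
      B≢C , B≢C , adj-CB j₀ , adj-CB j₁
    ¬is-c⇒¬two : ∀ {v} → Part v → is-c v ≡ false → ¬ TwoNonNeighbours v
    ¬is-c⇒¬two (A i) _ (y₁ , _ , _ , y₁≢v , _ , vy₁ , _) = contradiction (trans (≡.sym vy₁) (A-dominating i y₁ y₁≢v)) λ ()
    ¬is-c⇒¬two (B j) _ (y₁ , y₂ , y₁≢y₂ , y₁≢v , y₂≢v , vy₁ , vy₂) =
      y₁≢y₂ (trans (B-non-neighbour j (part y₁) y₁≢v vy₁) (≡.sym (B-non-neighbour j (part y₂) y₂≢v vy₂)))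
    ¬is-c⇒¬two C c≢c _ = contradiction (trans (≡.sym c≢c) (dec-true (c ≟ c) refl)) λ ()
    invariant : ∀ (σ : Aut H) → _ → ∀ v → key (Inverse.to (bij σ) v) ≡ key v
    invariant σ _ v = cong₂ _,_
      (key-invariant Dominating-invariant Outer.side (λ v → left⇒dominating (part v)) (λ v → right⇒¬dominating (part v)) σ v)
      (key-invariant TwoNonNeighbours-invariant is-c is-c⇒two (λ v → ¬is-c⇒¬two (part v)) σ v)
    determined : ∀ {u v} → Part u → Part v → key u ≡ key v → colour u ≡ colour v → u ≡ v
    determined (A i) (A i′) _ eq = cong (_↑ˡ (t + 1)) (f-injective (trans (≡.sym (colour-A i)) (trans eq (colour-A i′))))
    determined (B j) (B j′) _ eq =
      cong (λ j → s ↑ʳ (j ↑ˡ 1)) (g-injective (trans (≡.sym (colour-B j)) (trans eq (colour-B j′))))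
    determined C     C      _ _  = refl
    determined (A i) (B j)  eq _ =
      contradiction (trans (≡.sym (Outer.side-left i)) (trans (cong proj₁ eq) (Outer.side-right _))) λ ()
    determined (A i) C      eq _ =
      contradiction (trans (≡.sym (Outer.side-left i)) (trans (cong proj₁ eq) (Outer.side-right _))) λ ()
    determined (B j) (A i)  eq _ =
      contradiction (trans (≡.sym (Outer.side-left i)) (trans (cong proj₁ (≡.sym eq)) (Outer.side-right _))) λ ()
    determined C     (A i)  eq _ =
      contradiction (trans (≡.sym (Outer.side-left i)) (trans (cong proj₁ (≡.sym eq)) (Outer.side-right _))) λ ()
    determined (B j) C      eq _ =
      contradiction (trans (≡.sym (dec-false (_ ≟ c) B≢C)) (trans (cong proj₂ eq) (dec-true (c ≟ c) refl))) λ ()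
    determined C     (B j)  eq _ =
      contradiction (trans (≡.sym (dec-false (_ ≟ c) B≢C)) (trans (cong proj₂ (≡.sym eq)) (dec-true (c ≟ c) refl))) λ ()

D-K+K∪K₁ : ∀ s t {d} → 2 ≤ t → IsDistNum (K s +ᴳ (K t ∪ᴳ K 1)) d → d ≡ s ⊔ t
D-K+K∪K₁ s t 2≤t D = IsDistNum⇒≡ D lower
  (distinguishing (λ i → inject≤ i (ℕ.m≤m⊔n s t)) (λ j → inject≤ j (ℕ.m≤n⊔m s t))
                  (inject≤-injective _ _ _ _) (inject≤-injective _ _ _ _) 2≤t)
  where
  open K+K∪K₁ s t
  lower : ∀ k (c : Fin (s + (t + 1)) → Fin k) → Distinguishing Outer.H c → s ⊔ t ≤ k
  lower _ c c-dist = ℕ.⊔-lub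
    (twin-family≤colours (_↑ˡ (t + 1)) Outer.↑ˡ-injective′ (λ i i′ → Outer.Twins-left (Twins-K i i′)) c c-dist)
    (twin-family≤colours (λ j → s ↑ʳ (j ↑ˡ 1)) (Inner.↑ˡ-injective′ ∘ Outer.↑ʳ-injective′)
                         (λ j j′ → Outer.Twins-right (Inner.Twins-left (Twins-K j j′))) c c-dist)

complete⇒twins : ∀ {n m} {G : Graph n} {H : Graph m} → G ≅ H → (∀ u v → u ≢ v → adj H u v ≡ true) → ∀ x y → Twins G x y
complete⇒twins {G = G} φ complete x y z z≢x z≢y = trans (adjacent x z (≢-sym z≢x)) (≡.sym (adjacent y z (≢-sym z≢y)))
  where
  adjacent : ∀ u v → u ≢ v → adj G u v ≡ true
  adjacent u v u≢v = trans (≡.sym (pres φ u v)) (complete _ _ (u≢v ∘ to-injective (bij φ)))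

K+[K₀∪K₁]-complete : ∀ t u v → u ≢ v → adj (K t +ᴳ (K 0 ∪ᴳ K 1)) u v ≡ true
K+[K₀∪K₁]-complete t u v u≢v = by-view (view u) (view v) u≢v
  where
  open SumGraph true (K t) (K 0 ∪ᴳ K 1)
  by-view : ∀ {u v} → View u → View v → u ≢ v → adj H u v ≡ true
  by-view (left i)  (left i′) u≢v = trans (adj-left i i′) (K-adj {i = i} {i′} λ { refl → u≢v refl })
  by-view (left i)  (right j) _   = adj-cross i j
  by-view (right j) (left i)  _   = adj-cross′ i j
  by-view (right zero) (right zero) u≢v = contradiction refl u≢v

K₁∪K₁≅E₂ : (K 1 ∪ᴳ K 1) ≅ E 2
K₁∪K₁≅E₂ = ≅-E λ u v u≢v → by-view (view u) (view v) u≢v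
  where
  open SumGraph false (K 1) (K 1)
  by-view : ∀ {u v} → View u → View v → u ≢ v → adj H u v ≡ false
  by-view (left zero)  (left zero)  u≢v = contradiction refl u≢v
  by-view (left i)     (right j)    _   = adj-cross i j
  by-view (right j)    (left i)     _   = adj-cross′ i j
  by-view (right zero) (right zero) u≢v = contradiction refl u≢v

Listed : ∀ {n} → Graph n → ℕ → Set
Listed G ℓ = (G ≅ Kbip (ℓ + 1) (ℓ + 1))
           ⊎ (Σ ℕ λ t → ℓ + 1 ≤ t × G ≅ Kbip t ℓ)
           ⊎ (Σ ℕ λ t → ℓ ≤ t × G ≅ (K ℓ +ᴳ E t))
           ⊎ (Σ ℕ λ t → ℓ ≤ t × 2 ≤ ℓ × G ≅ (K t +ᴳ E ℓ))
           ⊎ (Σ ℕ λ t → 2 ⊔ (ℓ ∸ 1) ≤ t × G ≅ (K (ℓ ∸ 1) +ᴳ (K t ∪ᴳ K 1)))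
           ⊎ (Σ ℕ λ t → 2 ⊔ (ℓ ∸ 1) ≤ t × G ≅ (K t +ᴳ (K (ℓ ∸ 1) ∪ᴳ K 1)))

module Proposition {n} {G : Graph n} (connected : Connected G) {m} (dim : IsMetricDim G m) (m+2≡n : m + 2 ≡ n)
                   (2≤m : 2 ≤ m) {d} (D : IsDistNum G d) where

  open Dim≡n∸2 connected dim m+2≡n using (classification; non-twins)

  4≤n : 4 ≤ n
  4≤n = ≡.subst (4 ≤_) m+2≡n (ℕ.+-monoˡ-≤ 2 2≤m)

  private
    ℓ-from : ∀ {ℓ x y} → d ≡ x → n ≡ x + y → d + ℓ ≡ n → ℓ ≡ y
    ℓ-from {x = x} d≡x n≡x+y d+ℓ≡n = ℕ.+-cancelˡ-≡ x _ _ (trans (cong (_+ _) (≡.sym d≡x)) (trans d+ℓ≡n n≡x+y))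

    d+ℓ≡n-from : ∀ {ℓ x} → d ≡ x → n ≡ x + ℓ → d + ℓ ≡ n
    d+ℓ≡n-from d≡x n≡x+ℓ = trans (cong (_+ _) d≡x) (≡.sym n≡x+ℓ)

    +-exchange : ∀ s t → s + (t + 1) ≡ t + (s + 1)
    +-exchange = solve-∀

    balanced-size : ∀ ℓ → (ℓ + 1) + (ℓ + 1) ≡ suc (ℓ + 1) + ℓ
    balanced-size = solve-∀

    positive : ∀ {a k} → suc k ≤ a + a → 1 ≤ a
    positive {suc _} _ = s≤s z≤n

    2≤-of-4≤ : ∀ {ℓ t} → 4 ≤ ℓ + t → ℓ ≤ t → 2 ≤ t
    2≤-of-4≤ {ℓ} {t} 4≤ℓ+t ℓ≤t with 2 ℕ.≤? t
    ... | yes 2≤t = 2≤t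
    ... | no 2≰t  = contradiction (ℕ.≤-trans 4≤ℓ+t (ℕ.+-mono-≤ (ℕ.≤-trans ℓ≤t t≤1) t≤1)) λ { (s≤s (s≤s ())) }
      where t≤1 = ℕ.≤-pred (ℕ.≰⇒> 2≰t)

  balanced-ℓ : ∀ {ℓ a} → G ≅ Kbip a a → d + ℓ ≡ n → a ≡ ℓ + 1
  balanced-ℓ {ℓ} {a} φ d+ℓ≡n = trans (ℕ.+-cancelˡ-≡ a _ _ (begin
    a + a      ≡⟨ ≅⇒≡ φ ⟨
    n          ≡⟨ d+ℓ≡n ⟨
    d + ℓ      ≡⟨ cong (_+ ℓ) (D-Kbip-balanced a (positive (≡.subst (4 ≤_) (≅⇒≡ φ) 4≤n)) (≅-IsDistNum φ D)) ⟩
    suc a + ℓ  ≡⟨ ℕ.+-suc a ℓ ⟨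
    a + suc ℓ  ∎)) (ℕ.+-comm 1 ℓ)
    where open ≡.≡-Reasoning

  forward-Kbip : ∀ {ℓ} a b → b ≤ a → G ≅ Kbip a b → d + ℓ ≡ n → Listed G ℓ
  forward-Kbip a b b≤a φ d+ℓ≡n with ℕ.m≤n⇒m<n∨m≡n b≤a
  ... | inj₁ b<a with ℓ-from (D-Kbip-unbalanced a b b<a (≅-IsDistNum φ D)) (≅⇒≡ φ) d+ℓ≡n
  ...   | refl = inj₂ (inj₁ (a , ≡.subst (_≤ a) (ℕ.+-comm 1 b) b<a , φ))
  forward-Kbip a _ _ φ d+ℓ≡n | inj₂ refl with balanced-ℓ {a = a} φ d+ℓ≡n
  ...   | refl = inj₁ φ

  forward-K+E : ∀ {ℓ} a b → 2 ≤ b → G ≅ (K a +ᴳ E b) → d + ℓ ≡ n → Listed G ℓ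
  forward-K+E a b 2≤b φ d+ℓ≡n with ℕ.≤-total a b
  ... | inj₁ a≤b with ℓ-from (trans (D-K+E a b 2≤b (≅-IsDistNum φ D)) (ℕ.m≤n⇒m⊔n≡n a≤b))
                             (trans (≅⇒≡ φ) (ℕ.+-comm a b)) d+ℓ≡n
  ...   | refl = inj₂ (inj₂ (inj₁ (b , a≤b , φ)))
  forward-K+E a b 2≤b φ d+ℓ≡n | inj₂ b≤a with ℓ-from (trans (D-K+E a b 2≤b (≅-IsDistNum φ D)) (ℕ.m≥n⇒m⊔n≡m b≤a))
                                                     (≅⇒≡ φ) d+ℓ≡n
  ...   | refl = inj₂ (inj₂ (inj₂ (inj₁ (a , b≤a , 2≤b , φ))))

  forward-K+K∪K₁ : ∀ {ℓ} s t → 2 ≤ t → G ≅ (K s +ᴳ (K t ∪ᴳ K 1)) → d + ℓ ≡ n → Listed G ℓ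
  forward-K+K∪K₁ s t 2≤t φ d+ℓ≡n with ℕ.≤-total s t
  ... | inj₁ s≤t with ℓ-from (trans (D-K+K∪K₁ s t 2≤t (≅-IsDistNum φ D)) (ℕ.m≤n⇒m⊔n≡n s≤t))
                             (trans (≅⇒≡ φ) (+-exchange s t)) d+ℓ≡n
  ...   | refl rewrite ℕ.m+n∸n≡m s 1 = inj₂ (inj₂ (inj₂ (inj₂ (inj₁ (t , ℕ.⊔-lub 2≤t s≤t , φ)))))
  forward-K+K∪K₁ s t 2≤t φ d+ℓ≡n | inj₂ t≤s with ℓ-from (trans (D-K+K∪K₁ s t 2≤t (≅-IsDistNum φ D)) (ℕ.m≥n⇒m⊔n≡m t≤s))
                                                       (≅⇒≡ φ) d+ℓ≡n
  ...   | refl rewrite ℕ.m+n∸n≡m t 1 = inj₂ (inj₂ (inj₂ (inj₂ (inj₂ (s , ℕ.⊔-lub (ℕ.≤-trans 2≤t t≤s) t≤s , φ)))))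

  forward : ∀ {ℓ} → d + ℓ ≡ n → Listed G ℓ
  forward with classification
  ... | ≅Kbip a b b≤a φ   = forward-Kbip a b b≤a φ
  ... | ≅K+E a b 2≤b φ    = forward-K+E a b 2≤b φ
  ... | ≅K+K∪K₁ s t 2≤t φ = forward-K+K∪K₁ s t 2≤t φ

  not-complete : ∀ t → ¬ G ≅ (K t +ᴳ (K 0 ∪ᴳ K 1))
  not-complete t φ with non-twins
  ... | x , y , ¬x∼y = ¬x∼y (complete⇒twins φ (K+[K₀∪K₁]-complete t) x y)

  backward-K+K∪K₁ : ∀ ℓ t → 2 ⊔ (ℓ ∸ 1) ≤ t → G ≅ (K t +ᴳ (K (ℓ ∸ 1) ∪ᴳ K 1)) → d + ℓ ≡ n
  backward-K+K∪K₁ 0 t _ φ = ⊥-elim (not-complete t φ)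
  backward-K+K∪K₁ 1 t _ φ = ⊥-elim (not-complete t φ)
  backward-K+K∪K₁ 2 t bound φ = d+ℓ≡n-from
    (trans (D-K+E t 2 ℕ.≤-refl (≅-IsDistNum (≅-trans φ (sumGraph-cong ≅-refl K₁∪K₁≅E₂)) D))
           (ℕ.m≥n⇒m⊔n≡m (ℕ.m⊔n≤o⇒m≤o 2 1 bound)))
    (≅⇒≡ φ)
  backward-K+K∪K₁ (suc ℓ′@(suc (suc _))) t bound φ = d+ℓ≡n-from
    (trans (D-K+K∪K₁ t ℓ′ (s≤s (s≤s z≤n)) (≅-IsDistNum φ D)) (ℕ.m≥n⇒m⊔n≡m (ℕ.m⊔n≤o⇒n≤o 2 ℓ′ bound)))
    (trans (≅⇒≡ φ) (cong (t +_) (ℕ.+-comm ℓ′ 1)))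

  backward : ∀ ℓ → 1 ≤ ℓ → Listed G ℓ → d + ℓ ≡ n
  backward ℓ _ (inj₁ φ) = d+ℓ≡n-from
    (D-Kbip-balanced (ℓ + 1) (ℕ.m≤n+m 1 ℓ) (≅-IsDistNum φ D)) (trans (≅⇒≡ φ) (balanced-size ℓ))
  backward ℓ _ (inj₂ (inj₁ (t , ℓ+1≤t , φ))) = d+ℓ≡n-from
    (D-Kbip-unbalanced t ℓ (≡.subst (_≤ t) (ℕ.+-comm ℓ 1) ℓ+1≤t) (≅-IsDistNum φ D)) (≅⇒≡ φ)
  backward ℓ _ (inj₂ (inj₂ (inj₁ (t , ℓ≤t , φ)))) = d+ℓ≡n-from
    (trans (D-K+E ℓ t (2≤-of-4≤ (≡.subst (4 ≤_) (≅⇒≡ φ) 4≤n) ℓ≤t) (≅-IsDistNum φ D)) (ℕ.m≤n⇒m⊔n≡n ℓ≤t))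
    (trans (≅⇒≡ φ) (ℕ.+-comm ℓ t))
  backward ℓ _ (inj₂ (inj₂ (inj₂ (inj₁ (t , ℓ≤t , 2≤ℓ , φ))))) = d+ℓ≡n-from
    (trans (D-K+E t ℓ 2≤ℓ (≅-IsDistNum φ D)) (ℕ.m≥n⇒m⊔n≡m ℓ≤t)) (≅⇒≡ φ)
  backward (suc ℓ′) _ (inj₂ (inj₂ (inj₂ (inj₂ (inj₁ (t , bound , φ)))))) = d+ℓ≡n-from
    (trans (D-K+K∪K₁ ℓ′ t (ℕ.m⊔n≤o⇒m≤o 2 ℓ′ bound) (≅-IsDistNum φ D)) (ℕ.m≤n⇒m⊔n≡n (ℕ.m⊔n≤o⇒n≤o 2 ℓ′ bound)))
    (trans (≅⇒≡ φ) (trans (+-exchange ℓ′ t) (cong (t +_) (ℕ.+-comm ℓ′ 1))))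
  backward ℓ _ (inj₂ (inj₂ (inj₂ (inj₂ (inj₂ (t , bound , φ)))))) = backward-K+K∪K₁ ℓ t bound φ

proposition2p4 : ∀ {n} (G : Graph n) → Connected G →
    ∀ (m : ℕ) → IsMetricDim G m → m + 2 ≡ n → 2 ≤ m →
    ∀ (ℓ : ℕ) → 1 ≤ ℓ →
    ∀ (d : ℕ) → IsDistNum G d →
    (d + ℓ ≡ n) ⇔
      (  (G ≅ Kbip (ℓ + 1) (ℓ + 1))
      ⊎ (Σ ℕ λ t → ℓ + 1 ≤ t × G ≅ Kbip t ℓ)
      ⊎ (Σ ℕ λ t → ℓ ≤ t × G ≅ (K ℓ +ᴳ E t))
      ⊎ (Σ ℕ λ t → ℓ ≤ t × 2 ≤ ℓ × G ≅ (K t +ᴳ E ℓ))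
      ⊎ (Σ ℕ λ t → 2 ⊔ (ℓ ∸ 1) ≤ t × G ≅ (K (ℓ ∸ 1) +ᴳ (K t ∪ᴳ K 1)))
      ⊎ (Σ ℕ λ t → 2 ⊔ (ℓ ∸ 1) ≤ t × G ≅ (K t +ᴳ (K (ℓ ∸ 1) ∪ᴳ K 1))))
proposition2p4 G connected m dim m+2≡n 2≤m ℓ 1≤ℓ d D = mk⇔ forward (backward ℓ 1≤ℓ)
  where open Proposition connected dim m+2≡n 2≤m D
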